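{- A function $f\colon[0,1]\to\mathbb{R}$ is uniformly continuous if and only if $f$ is induced by a uniformly continuous code.
   Context: The setting is constructive. Reals: - Real numbers are regular sequences of rationals $\langle r_n\rangle$ with $|r_n-r_{n+1}|\le2^{ -(n+1)}$, with equality $\langle r_n\rangle\simeq\langle q_n\rangle$ iff $\forall n\,|r_{n+1}-q_{n+1}|\le2^{ -n}$. Functions $[0,1]\to\mathbb{R}$ respect $\simeq$. - $f$ is uniformly continuous if there is $\omega$ with $\forall k\,\forall x,y\in[0,1]\,(|x-y|\le2^{ -\omega(k)}\to|f(x)-f(y)|\le2^{ -k})$. Ternary tree: - For $s\in\{0,1,2\}^*$, define $N(\langle\rangle)=1$ and $N(s*\langle i\rangle)=2N(s)+(i-1)$. - For $\alpha\in\{0,1,2\}^{\mathbb{N}}$, $\Phi(\alpha)=\langle2^{ -(n+1)}N(\overline{\alpha}n)\rangle_n$. - For $s\in\{0,1,2\}^*$, $\mathbb{I}_s=(2^{ -(|s|+1)}(N(s)-1),\,2^{ -(|s|+1)}(N(s)+1))$. Rational intervals: - $\mathbb{T}=\{(p,q)\in\mathbb{Q}^2:p\le q\}$, identified with a subset of $\mathbb{N}$ via a fixed coding. - For $I=(p,q)$: $|I|=q-p$. - $(p,q)\sqsubseteq(p',q')$ iff $p'\le p$ and $q\le q'$. - $(p,q)\approx(p',q')$ iff $p'\le q$ and $p\le q'$. - $\dot-$ is truncated subtraction. Codes: - A code of a continuous function is $\varphi\colon\{0,1,2\}^*\to\mathbb{N}$ such that: (C1) $\varphi(s)\ne0\to\varphi(s)\dot-1\in\mathbb{T}$;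 (C2) $\forall k\,\forall\alpha\,\exists n\,(\varphi(\overline{\alpha}n)\ne0\wedge|\varphi(\overline{\alpha}n)\dot-1|\le2^{ -k})$; (C3) for all $s$ and $i\in\{0,1,2\}$, $\varphi(s)\ne0\to(\varphi(s*\langle i\rangle)\ne0\wedge\varphi(s*\langle i\rangle)\dot-1\sqsubseteq\varphi(s)\dot-1)$; (C4) for all $s,t$, $(\varphi(s)\ne0\wedge\varphi(t)\ne0\wedge\mathbb{I}_s\approx\mathbb{I}_t)\to\varphi(s)\dot-1\approx\varphi(t)\dot-1$. - A code is uniformly continuous if $\forall k\,\exists n\,\forall\alpha\in\{0,1,2\}^{\mathbb{N}}\,(\varphi(\overline{\alpha}n)\ne0\wedge|\varphi(\overline{\alpha}n)\dot-1|\le2^{ -k})$. - For a code $\varphi$, let $h_k(\alpha)$ be the least $n$ with $\varphi(\overline{\alpha}n)\ne0$ and $|\varphi(\overline{\alpha}n)\dot-1|\le2^{ -k}$. Let $f^\varphi_T(\alpha)=\langle\varphi(\overline{\alpha}h_n(\alpha))\dot-1\rangle_n$. This is a shrinking sequence of intervals $\langle\mathbb{J}_n\rangle$: $\mathbb{J}_{n+1}\sqsubseteq\mathbb{J}_n$ and $\forall k\,\exists n\,|\mathbb{J}_n|\le2^{ -k}$. - A shrinking sequence determines the real number $\langle\text{left endpoint of }\mathbb{J}_{\delta(n)}\rangle_n$, where $\delta(k)$ is the least $n$ with $|\mathbb{J}_n|\le2^{ -(k+1)}$. - $f$ is induced by $\varphi$ if for every $\alpha$, $f(\Phi(\alpha))$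 equals the real number determined by $f^\varphi_T(\alpha)$. -}

module Defs where

open import Data.Nat as ℕ using (ℕ; zero; suc)
open import Data.Integer as ℤ using (ℤ; +_)
open import Data.Fin using (Fin; toℕ)
open import Data.List using (List; []; _∷_; _∷ʳ_; length; foldl)
open import Data.Maybe using (Maybe; just; nothing; fromMaybe)
open import Data.Product using (Σ; _×_; _,_; proj₁; proj₂)
open import Data.Unit using (⊤)
open import Data.Empty using (⊥)
open import Relation.Nullary using (Dec; yes; no)
open import Relation.Unary using (Decidable)
open import Data.Rational.Unnormalised using (ℚᵘ; mkℚᵘ; 0ℚᵘ; 1ℚᵘ; _≤_; _+_; _-_; ∣_∣)
open import Data.Rational.Unnormalised.Properties using (_≤?_)
import Data.Rational.Unnormalised.Properties as ℚP
open import Data.Rational.Unnormalised using (*≤*)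
import Data.Nat.Properties as ℕP
import Data.Integer.Properties as ℤP
open import Data.Integer.Tactic.RingSolver using (solve-∀)
import Data.Nat.Tactic.RingSolver as NS
open import Data.Fin using (zero; suc)
import Data.List.Properties as LP
open import Relation.Binary.PropositionalEquality using (_≡_; refl; sym; trans; cong; subst; subst₂)

-- Powers of two.
-- pow2-1 n = 2^n - 1, so that  mkℚᵘ a (pow2-1 n)  is the rational a / 2^n.

pow2-1 : ℕ → ℕ
pow2-1 zero    = zero
pow2-1 (suc n) = suc (2 ℕ.* pow2-1 n)

ε : ℕ → ℚᵘ
ε n = mkℚᵘ (+ 1) (pow2-1 n)

Seq : Set
Seq = ℕ → ℚᵘ

IsRegular : Seq → Set
IsRegular r = ∀ n → ∣ r n - r (suc n) ∣ ≤ ε (suc n)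

record ℝ : Set where
  constructor mkℝ
  field
    seq : Seq
    reg : IsRegular seq
open ℝ public

_≃ʳ_ : Seq → Seq → Set
r ≃ʳ q = ∀ n → ∣ r (suc n) - q (suc n) ∣ ≤ ε n

_≤ʳ_ : Seq → Seq → Set
r ≤ʳ q = ∀ n → r (suc n) ≤ q (suc n) + ε n

constʳ : ℚᵘ → Seq
constʳ a n = a

_-ʳ_ : Seq → Seq → Seq
(r -ʳ q) n = r (suc n) - q (suc n)

absʳ : Seq → Seq
absʳ r n = ∣ r n ∣

record Pt01 : Set where
  constructor mkPt
  field
    pt : ℝ
    lo : constʳ 0ℚᵘ ≤ʳ seq pt
    hi : seq pt ≤ʳ constʳ 1ℚᵘ
open Pt01 public

record Fun01 : Set where
  field
    app : Pt01 → ℝ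
    ext : ∀ x y → seq (pt x) ≃ʳ seq (pt y) → seq (app x) ≃ʳ seq (app y)
open Fun01 public

UniformlyContinuous : Fun01 → Set
UniformlyContinuous f =
  Σ (ℕ → ℕ) λ ω → ∀ k (x y : Pt01) →
    absʳ (seq (pt x) -ʳ seq (pt y)) ≤ʳ constʳ (ε (ω k)) →
    absʳ (seq (app f x) -ʳ seq (app f y)) ≤ʳ constʳ (ε k)

-- Ternary tree.  Finite sequences s ∈ {0,1,2}* are lists over Fin 3,
-- s * ⟨i⟩ is  s ∷ʳ i.

Seq3 : Set
Seq3 = List (Fin 3)

N : Seq3 → ℤ
N s = foldl (λ a i → + 2 ℤ.* a ℤ.+ (+ toℕ i ℤ.- + 1)) (+ 1) s

prefix : (ℕ → Fin 3) → ℕ → Seq3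
prefix α zero    = []
prefix α (suc n) = prefix α n ∷ʳ α n

Φseq : (ℕ → Fin 3) → Seq
Φseq α n = mkℚᵘ (N (prefix α n)) (pow2-1 (suc n))

-- Rational intervals (p , q), as pairs; 𝕋 is the set of pairs with p ≤ q.

Interval : Set
Interval = ℚᵘ × ℚᵘ

left : Interval → ℚᵘ
left = proj₁

width : Interval → ℚᵘ
width (p , q) = q - p

_⊑_ : Interval → Interval → Set
(p , q) ⊑ (p' , q') = (p' ≤ p) × (q ≤ q')

_≈ᴵ_ : Interval → Interval → Set
(p , q) ≈ᴵ (p' , q') = (p' ≤ q) × (p ≤ q')

𝕀 : Seq3 → Interval
𝕀 s = mkℚᵘ (N s ℤ.- + 1) (pow2-1 (suc (length s)))
    , mkℚᵘ (N s ℤ.+ + 1) (pow2-1 (suc (length s)))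

-- Codes.  A value φ(s) ∈ ℕ is represented as an element of Maybe Interval:
-- φ(s) = 0 corresponds to nothing, φ(s) ≠ 0 to  just (φ(s) ∸ 1).

InT : Maybe Interval → Set
InT nothing        = ⊤
InT (just (p , q)) = p ≤ q

Small : ℕ → Maybe Interval → Set
Small k nothing  = ⊥
Small k (just I) = width I ≤ ε k

Small? : ∀ k (m : Maybe Interval) → Dec (Small k m)
Small? k nothing  = no (λ ())
Small? k (just I) = width I ≤? ε k

Refines : Maybe Interval → Maybe Interval → Set
Refines m        nothing  = ⊤
Refines nothing  (just I) = ⊥
Refines (just J) (just I) = J ⊑ I

Compatible : Maybe Interval → Maybe Interval → Set
Compatible (just I) (just J) = I ≈ᴵ J
Compatible _        _        = ⊤

record Code : Set where
  field
    φ  : Seq3 → Maybe Interval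
    c1 : ∀ s → InT (φ s)
    c2 : ∀ k (α : ℕ → Fin 3) → Σ ℕ λ n → Small k (φ (prefix α n))
    c3 : ∀ s i → Refines (φ (s ∷ʳ i)) (φ s)
    c4 : ∀ s t → 𝕀 s ≈ᴵ 𝕀 t → Compatible (φ s) (φ t)
open Code public

UniformlyContinuousCode : Code → Set
UniformlyContinuousCode c =
  ∀ k → Σ ℕ λ n → ∀ (α : ℕ → Fin 3) → Small k (φ c (prefix α n))

-- Bounded minimisation: least n ≤ B with P n (B if there is none).

searchFrom : {P : ℕ → Set} → Decidable P → ℕ → ℕ → ℕ
searchFrom P? i zero    = i
searchFrom P? i (suc b) with P? i
... | yes _ = i
... | no  _ = searchFrom P? (suc i) b

μ≤ : {P : ℕ → Set} → Decidable P → ℕ → ℕ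
μ≤ P? B = searchFrom P? 0 B

h : Code → ℕ → (ℕ → Fin 3) → ℕ
h c k α = μ≤ (λ n → Small? k (φ c (prefix α n))) (proj₁ (c2 c k α))

-- f^φ_T(α) = ⟨ φ(ᾱ h_n(α)) ∸ 1 ⟩_n   (φ(ᾱ h_n(α)) ≠ 0, so the default is never used)
fT : Code → (ℕ → Fin 3) → ℕ → Interval
fT c α n = fromMaybe (0ℚᵘ , 0ℚᵘ) (φ c (prefix α (h c n α)))

-- real number determined by a shrinking sequence J (with |J_n| ≤ 2^{-n}):
-- ⟨ left endpoint of J_{δ(k)} ⟩, δ(k) least n with |J_n| ≤ 2^{-(k+1)}
-- (δ(k) ≤ k+1 since |J_{k+1}| ≤ 2^{-(k+1)})
δ : (ℕ → Interval) → ℕ → ℕ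
δ J k = μ≤ (λ n → width (J n) ≤? ε (suc k)) (suc k)

determined : (ℕ → Interval) → Seq
determined J k = left (J (δ J k))

bound : ∀ (X : ℤ) D D' → ℤ.∣ X ∣ ℕ.≤ D → D' ≡ 2 ℕ.* D →
        + ℤ.∣ X ∣ ℤ.* + D ℤ.≤ + 1 ℤ.* + (D ℕ.* D')
bound X D D' le refl
  rewrite ℤP.*-identityˡ (+ (D ℕ.* (2 ℕ.* D))) | sym (ℤP.pos-* ℤ.∣ X ∣ D)
  = ℤ.+≤+ (ℕP.≤-trans (ℕP.*-monoˡ-≤ D le) (ℕP.*-monoʳ-≤ D (ℕP.m≤n*m D 2)))


s0 : ∀ a D → a ℤ.* (+ 2 ℤ.* D) ℤ.+ ℤ.- (+ 2 ℤ.* a ℤ.+ ℤ.-[1+ 0 ]) ℤ.* D ≡ D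
s0 = solve-∀
s1 : ∀ a D → a ℤ.* (+ 2 ℤ.* D) ℤ.+ ℤ.- (+ 2 ℤ.* a ℤ.+ + 0) ℤ.* D ≡ + 0
s1 = solve-∀
s2 : ∀ a D → a ℤ.* (+ 2 ℤ.* D) ℤ.+ ℤ.- (+ 2 ℤ.* a ℤ.+ + 1) ℤ.* D ≡ ℤ.- D
s2 = solve-∀

reg-lemma : ∀ (a : ℤ) d d' (i : Fin 3) → suc d' ≡ 2 ℕ.* suc d →
  ∣ mkℚᵘ a d - mkℚᵘ (+ 2 ℤ.* a ℤ.+ (+ toℕ i ℤ.- + 1)) d' ∣ ≤ mkℚᵘ (+ 1) d
reg-lemma a d d' i eq = *≤* (bound X (suc d) (suc d') (xb i) eq)
  where
  a' = + 2 ℤ.* a ℤ.+ (+ toℕ i ℤ.- + 1)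
  X = a ℤ.* + suc d' ℤ.+ ℤ.- a' ℤ.* + suc d
  e : + suc d' ≡ + 2 ℤ.* + suc d
  e = trans (cong +_ eq) (ℤP.pos-* 2 (suc d))
  xb : ∀ i → ℤ.∣ a ℤ.* + suc d' ℤ.+ ℤ.- (+ 2 ℤ.* a ℤ.+ (+ toℕ i ℤ.- + 1)) ℤ.* + suc d ∣ ℕ.≤ suc d
  Xf : ℤ → ℤ → ℤ
  Xf D' j = a ℤ.* D' ℤ.+ ℤ.- (+ 2 ℤ.* a ℤ.+ j) ℤ.* + suc d
  fix : ∀ j r → Xf (+ 2 ℤ.* + suc d) j ≡ r → ℤ.∣ r ∣ ℕ.≤ suc d → ℤ.∣ Xf (+ suc d') j ∣ ℕ.≤ suc d
  fix j r p le = subst (λ z → ℤ.∣ z ∣ ℕ.≤ suc d) (sym (trans (cong (λ D' → Xf D' j) e) p)) le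
  xb zero = fix _ _ (s0 a (+ suc d)) ℕP.≤-refl
  xb (suc zero) = fix _ _ (s1 a (+ suc d)) ℕ.z≤n
  xb (suc (suc zero)) = fix _ _ (s2 a (+ suc d)) ℕP.≤-refl


stepZ : ℤ → Fin 3 → ℤ
stepZ a i = + 2 ℤ.* a ℤ.+ (+ toℕ i ℤ.- + 1)

m' : Fin 3 → ℕ → ℕ
m' zero m = m ℕ.+ m
m' (suc zero) m = suc (m ℕ.+ m)
m' (suc (suc zero)) m = suc (suc (m ℕ.+ m))
k' : Fin 3 → ℕ → ℕ
k' zero k = suc (suc (k ℕ.+ k))
k' (suc zero) k = suc (k ℕ.+ k)
k' (suc (suc zero)) k = k ℕ.+ k

two : ∀ m → + 2 ℤ.* + suc m ≡ + suc (suc (m ℕ.+ m))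
two m = trans (sym (ℤP.pos-* 2 (suc m))) (cong +_ (twoN m))
  where
  twoN : ∀ m → 2 ℕ.* suc m ≡ suc (suc (m ℕ.+ m))
  twoN = NS.solve-∀

stepN : ∀ m (i : Fin 3) → stepZ (+ suc m) i ≡ + suc (m' i m)
stepN m i = trans (cong (λ z → z ℤ.+ (+ toℕ i ℤ.- + 1)) (two m)) (aux i)
  where
  aux : ∀ i → + suc (suc (m ℕ.+ m)) ℤ.+ (+ toℕ i ℤ.- + 1) ≡ + suc (m' i m)
  aux zero = refl
  aux (suc zero) = cong +_ (ℕP.+-identityʳ _)
  aux (suc (suc zero)) = cong +_ (ℕP.+-comm _ 1)

stepD : ∀ m k (i : Fin 3) → 2 ℕ.* (suc m ℕ.+ suc k) ≡ suc (m' i m) ℕ.+ suc (k' i k)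
stepD m k zero = d0 m k
  where
  d0 : ∀ m k → 2 ℕ.* (suc m ℕ.+ suc k) ≡ suc (m ℕ.+ m) ℕ.+ suc (suc (suc (k ℕ.+ k)))
  d0 = NS.solve-∀
stepD m k (suc zero) = d1 m k
  where
  d1 : ∀ m k → 2 ℕ.* (suc m ℕ.+ suc k) ≡ suc (suc (m ℕ.+ m)) ℕ.+ suc (suc (k ℕ.+ k))
  d1 = NS.solve-∀
stepD m k (suc (suc zero)) = d2 m k
  where
  d2 : ∀ m k → 2 ℕ.* (suc m ℕ.+ suc k) ≡ suc (suc (suc (m ℕ.+ m))) ℕ.+ suc (k ℕ.+ k)
  d2 = NS.solve-∀


pow2-step : ∀ j → suc (pow2-1 (suc j)) ≡ 2 ℕ.* suc (pow2-1 j)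
pow2-step j = cong suc (sym (ℕP.+-suc (pow2-1 j) (pow2-1 j ℕ.+ 0)))

N-step : ∀ s i → N (s ∷ʳ i) ≡ stepZ (N s) i
N-step s i = LP.foldl-∷ʳ (λ a i → + 2 ℤ.* a ℤ.+ (+ toℕ i ℤ.- + 1)) (+ 1) i s

inv : ∀ α n → Σ ℕ λ m → Σ ℕ λ k →
      (N (prefix α n) ≡ + suc m) × (suc (pow2-1 (suc n)) ≡ suc m ℕ.+ suc k)
inv α zero = 0 , 0 , refl , refl
inv α (suc n) with inv α n
... | m , k , eN , eD =
  m' (α n) m , k' (α n) k ,
  trans (N-step (prefix α n) (α n)) (trans (cong (λ z → stepZ z (α n)) eN) (stepN m (α n))) ,
  trans (pow2-step (suc n)) (trans (cong (2 ℕ.*_) eD) (stepD m k (α n)))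

Φreg : ∀ α → IsRegular (Φseq α)
Φreg α n =
  subst (λ z → ∣ Φseq α n - mkℚᵘ z (pow2-1 (suc (suc n))) ∣ ≤ ε (suc n))
        (sym (N-step (prefix α n) (α n)))
        (reg-lemma (N (prefix α n)) (pow2-1 (suc n)) (pow2-1 (suc (suc n))) (α n) (pow2-step (suc n)))

lo-lemma : ∀ a d m → a ≡ + suc m → 0ℚᵘ ≤ mkℚᵘ a d
lo-lemma _ d m refl = *≤* (ℤ.+≤+ ℕ.z≤n)

hi-lemma : ∀ a d m k → a ≡ + suc m → suc d ≡ suc m ℕ.+ suc k → mkℚᵘ a d ≤ 1ℚᵘ
hi-lemma _ d m k refl e = *≤* (subst₂ ℤ._≤_ (sym (ℤP.*-identityʳ (+ suc m))) (sym (ℤP.*-identityˡ (+ suc d)))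
                               (ℤ.+≤+ (subst (suc m ℕ.≤_) (sym e) (ℕP.m≤m+n (suc m) (suc k)))))

ε≥0 : ∀ n → 0ℚᵘ ≤ ε n
ε≥0 n = *≤* (ℤ.+≤+ ℕ.z≤n)

Φlo : ∀ α → constʳ 0ℚᵘ ≤ʳ Φseq α
Φlo α n with inv α (suc n)
... | m , k , eN , eD =
  ℚP.≤-trans (*≤* (ℤ.+≤+ ℕ.z≤n)) (ℚP.+-mono-≤ (lo-lemma _ (pow2-1 (suc (suc n))) m eN) (ε≥0 n))

Φhi : ∀ α → Φseq α ≤ʳ constʳ 1ℚᵘ
Φhi α n with inv α (suc n)
... | m , k , eN , eD =
  ℚP.≤-trans (ℚP.≤-reflexive (ℚP.≃-sym (ℚP.+-identityʳ (Φseq α (suc n)))))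
             (ℚP.+-mono-≤ (hi-lemma _ (pow2-1 (suc (suc n))) m k eN eD) (ε≥0 n))

Φ : (ℕ → Fin 3) → Pt01
Φ α = mkPt (mkℝ (Φseq α) (Φreg α)) (Φlo α) (Φhi α)

InducedBy : Fun01 → Code → Set
InducedBy f c = ∀ (α : ℕ → Fin 3) → seq (app f (Φ α)) ≃ʳ determined (fT c α)

-- Given a modulus ω for f, let φ(s) be the intersection of the intervals f(c)ⱼ₊₃ ± 2⁻⁽ʲ⁺¹⁾ over the j
-- with ℓ j ≤ |s|, where c is the centre of 𝕀 of the prefix of s of length ℓ j.  The depths ℓ j grow
-- fast enough (in terms of ω) that overlapping intervals 𝕀 at depth ℓ j carry f-values within
-- 2⁻⁽ʲ⁺²⁾, so all these intervals pairwise overlap: φ is a code, it has width ≤ 2⁻ʲ from depth ℓ j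
-- on, and φ(ᾱ n) contains f(Φ α), which is therefore the real number determined by f^φ_T(α).
-- Conversely, if φ(ᾱ n) has width ≤ 2⁻⁽ᵏ⁺²⁾ for every α, two points within 2⁻⁽ⁿ⁺²⁾ have ternary
-- expansions α, β with overlapping 𝕀(ᾱ n) and 𝕀(β̄ n); by (C4) the intervals φ(ᾱ n) and φ(β̄ n),
-- which contain f(Φ α) and f(Φ β), overlap, so these values are within 3 · 2⁻⁽ᵏ⁺²⁾.

module Submission where

open import Defs
open import Data.Nat as ℕ using (ℕ; zero; suc)
open import Data.Integer as ℤ using (ℤ; +_)
import Data.Integer.Properties as ℤP
import Data.Nat.Properties as ℕP
open import Data.Rational.Unnormalised
  using (ℚᵘ; mkℚᵘ; 0ℚᵘ; 1ℚᵘ; _≤_; _<_; _+_; _-_; -_; ∣_∣; _≃_; _⊔_; _⊓_; *≤*; *<*; *≡*; nonNegative)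
import Data.Rational.Unnormalised.Properties as ℚP
open import Data.Rational.Unnormalised.Solver using (module +-*-Solver)
import Data.Integer.Tactic.RingSolver as ℤSolver
open import Data.Sum using (inj₁; inj₂)
open import Data.Product using (Σ; _×_; _,_; proj₁; proj₂)
open import Data.Empty using (⊥-elim)
open import Relation.Nullary using (yes; no; ¬_)
open import Relation.Binary.PropositionalEquality using (_≡_; refl; sym; trans; cong; subst; subst₂; module ≡-Reasoning)
open import Data.Fin using (Fin; toℕ; zero; suc)
open import Data.List using (List; []; _∷_; _∷ʳ_; length; _++_; take; drop; replicate)
import Data.List.Properties as LP
open import Relation.Unary using (Decidable)
open import Data.Maybe using (Maybe; just; nothing)
open import Data.Unit using (⊤; tt)
open +-*-Solver

-- Linear arithmetic over ℚᵘ: every inequality below is reduced to a sum of known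
-- inequalities plus a ring identity discharged by the solver.
≤-cancel : ∀ {a b x y} → x ≤ y → a + y ≃ b + x → a ≤ b
≤-cancel {a} {b} {x} {y} x≤y eq = begin
  a               ≃⟨ shift a x ⟩
  (a + x) + - x   ≤⟨ ℚP.+-monoˡ-≤ (- x) (ℚP.+-monoʳ-≤ a x≤y) ⟩
  (a + y) + - x   ≃⟨ ℚP.+-congˡ (- x) eq ⟩
  (b + x) + - x   ≃⟨ ℚP.≃-sym (shift b x) ⟩
  b               ∎
  where
  open ℚP.≤-Reasoning
  shift : ∀ a x → a ≃ (a + x) + - x
  shift = solve 2 (λ a x → a := (a :+ x) :+ :- x) ℚP.≃-refl

p≤∣p∣ : ∀ p → p ≤ ∣ p ∣
p≤∣p∣ p with ℚP.∣p∣≡p∨∣p∣≡-p p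
... | inj₁ e = ℚP.≤-reflexive-≡ (sym e)
... | inj₂ e = ≤-cancel (ℚP.+-mono-≤ (ℚP.0≤∣p∣ p) (ℚP.0≤∣p∣ p))
                 (ℚP.≃-trans (ℚP.+-congʳ p (ℚP.+-congʳ ∣ p ∣ (ℚP.≃-reflexive e))) (eq p ∣ p ∣))
  where
  eq : ∀ p q → p + (q + - p) ≃ q + (0ℚᵘ + 0ℚᵘ)
  eq = solve 2 (λ p q → p :+ (q :+ :- p) := q :+ (con 0ℚᵘ :+ con 0ℚᵘ)) ℚP.≃-refl

-p≤∣p∣ : ∀ p → - p ≤ ∣ p ∣
-p≤∣p∣ p = ℚP.≤-respʳ-≃ (ℚP.∣-p∣≃∣p∣ p) (p≤∣p∣ (- p))

-p≤q∧p≤q⇒∣p∣≤q : ∀ {p q} → - p ≤ q → p ≤ q → ∣ p ∣ ≤ q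
-p≤q∧p≤q⇒∣p∣≤q {p} -p≤q p≤q with ℚP.∣p∣≡p∨∣p∣≡-p p
... | inj₁ e = subst (_≤ _) (sym e) p≤q
... | inj₂ e = subst (_≤ _) (sym e) -p≤q

record Dist (x y d : ℚᵘ) : Set where
  constructor dist
  field ∣-∣≤ : ∣ x - y ∣ ≤ d
open Dist public

dist-intro : ∀ {x y d} → x ≤ y + d → y ≤ x + d → Dist x y d
dist-intro {x} {y} {d} x≤y+d y≤x+d =
  dist (-p≤q∧p≤q⇒∣p∣≤q (≤-cancel y≤x+d (eq₁ x y d)) (≤-cancel x≤y+d (eq₂ x y d)))
  where
  eq₁ : ∀ x y d → - (x - y) + (x + d) ≃ d + y
  eq₁ = solve 3 (λ x y d → :- (x :- y) :+ (x :+ d) := d :+ y) ℚP.≃-refl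
  eq₂ : ∀ x y d → (x - y) + (y + d) ≃ d + x
  eq₂ = solve 3 (λ x y d → (x :- y) :+ (y :+ d) := d :+ x) ℚP.≃-refl

dist-≤ : ∀ {x y d} → Dist x y d → x ≤ y + d
dist-≤ {x} {y} {d} (dist h) = ≤-cancel (ℚP.≤-trans (p≤∣p∣ (x - y)) h) (eq x y d)
  where
  eq : ∀ x y d → x + d ≃ (y + d) + (x - y)
  eq = solve 3 (λ x y d → x :+ d := (y :+ d) :+ (x :- y)) ℚP.≃-refl

dist-≥ : ∀ {x y d} → Dist x y d → y ≤ x + d
dist-≥ {x} {y} {d} (dist h) = ≤-cancel (ℚP.≤-trans (-p≤∣p∣ (x - y)) h) (eq x y d)
  where
  eq : ∀ x y d → y + d ≃ (x + d) + - (x - y)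
  eq = solve 3 (λ x y d → y :+ d := (x :+ d) :+ :- (x :- y)) ℚP.≃-refl

dist-sym : ∀ {x y d} → Dist x y d → Dist y x d
dist-sym h = dist-intro (dist-≥ h) (dist-≤ h)

dist-trans : ∀ {x y z d e} → Dist x y d → Dist y z e → Dist x z (d + e)
dist-trans {x} {y} {z} {d} {e} h₁ h₂ = dist-intro
  (≤-cancel (ℚP.+-mono-≤ (dist-≤ h₁) (dist-≤ h₂)) (eq₁ x y z d e))
  (≤-cancel (ℚP.+-mono-≤ (dist-≥ h₁) (dist-≥ h₂)) (eq₂ x y z d e))
  where
  eq₁ : ∀ x y z d e → x + (y + d + (z + e)) ≃ (z + (d + e)) + (x + y)
  eq₁ = solve 5 (λ x y z d e → x :+ (y :+ d :+ (z :+ e)) := (z :+ (d :+ e)) :+ (x :+ y)) ℚP.≃-refl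
  eq₂ : ∀ x y z d e → z + (x + d + (y + e)) ≃ (x + (d + e)) + (y + z)
  eq₂ = solve 5 (λ x y z d e → z :+ (x :+ d :+ (y :+ e)) := (x :+ (d :+ e)) :+ (y :+ z)) ℚP.≃-refl

dist-mono : ∀ {x y d e} → Dist x y d → d ≤ e → Dist x y e
dist-mono (dist h) d≤e = dist (ℚP.≤-trans h d≤e)

dist-refl : ∀ x {d} → 0ℚᵘ ≤ d → Dist x x d
dist-refl x {d} 0≤d = dist-intro (≤-cancel 0≤d (eq x d)) (≤-cancel 0≤d (eq x d))
  where
  eq : ∀ x d → x + d ≃ (x + d) + 0ℚᵘ
  eq = solve 2 (λ x d → x :+ d := (x :+ d) :+ con 0ℚᵘ) ℚP.≃-refl

dist-cong : ∀ {x x' y y' d} → x ≃ x' → y ≃ y' → Dist x y d → Dist x' y' d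
dist-cong x≃x' y≃y' (dist h) = dist (ℚP.≤-respˡ-≃ (ℚP.∣-∣-cong (ℚP.+-cong x≃x' (ℚP.-‿cong y≃y'))) h)

+-sameDenominator : ∀ a b d → mkℚᵘ a d + mkℚᵘ b d ≃ mkℚᵘ (a ℤ.+ b) d
+-sameDenominator a b d = *≡* (eq a b (+ suc d))
  where
  eq : ∀ a b D → (a ℤ.* D ℤ.+ b ℤ.* D) ℤ.* D ≡ (a ℤ.+ b) ℤ.* (D ℤ.* D)
  eq = ℤSolver.solve-∀

mkℚᵘ-scale : ∀ a k d d' → suc d' ≡ suc k ℕ.* suc d → mkℚᵘ a d ≃ mkℚᵘ (+ suc k ℤ.* a) d'
mkℚᵘ-scale a k d d' d'≡kd = *≡* (begin
  a ℤ.* + suc d'               ≡⟨ cong (λ m → a ℤ.* + m) d'≡kd ⟩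
  a ℤ.* + (suc k ℕ.* suc d)    ≡⟨ cong (a ℤ.*_) (sym (ℤP.pos-* (suc k) (suc d))) ⟩
  a ℤ.* (+ suc k ℤ.* + suc d)  ≡⟨ eq a (+ suc k) (+ suc d) ⟩
  (+ suc k ℤ.* a) ℤ.* + suc d  ∎)
  where
  open ≡-Reasoning
  eq : ∀ a K D → a ℤ.* (K ℤ.* D) ≡ (K ℤ.* a) ℤ.* D
  eq = ℤSolver.solve-∀

mkℚᵘ-mono-≤ : ∀ {a b} d → a ℤ.≤ b → mkℚᵘ a d ≤ mkℚᵘ b d
mkℚᵘ-mono-≤ d a≤b = *≤* (ℤP.*-monoʳ-≤-nonNeg (+ suc d) a≤b)

0≤ε : ∀ n → 0ℚᵘ ≤ ε n
0≤ε n = ℚP.nonNegative⁻¹ (ε n)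

ε-half : ∀ n → ε (suc n) + ε (suc n) ≃ ε n
ε-half n = ℚP.≃-trans (+-sameDenominator (+ 1) (+ 1) (pow2-1 (suc n)))
                      (ℚP.≃-sym (mkℚᵘ-scale (+ 1) 1 (pow2-1 n) (pow2-1 (suc n)) (pow2-step n)))

ε-suc≤ε : ∀ n → ε (suc n) ≤ ε n
ε-suc≤ε n = ≤-cancel (0≤ε (suc n)) (ℚP.≃-trans (ε-half n) (ℚP.≃-sym (ℚP.+-identityʳ (ε n))))

ε-suc<ε : ∀ n → ε (suc n) < ε n
ε-suc<ε n = ℚP.<-respʳ-≃ (ε-half n)
  (ℚP.<-respˡ-≃ (ℚP.+-identityʳ (ε (suc n))) (ℚP.+-monoʳ-< (ε (suc n)) (ℚP.positive⁻¹ (ε (suc n)))))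

ε-antitone : ∀ {m n} → m ℕ.≤ n → ε n ≤ ε m
ε-antitone {m} m≤n with ℕP.m≤n⇒∃[o]m+o≡n m≤n
... | o , refl = go m o
  where
  go : ∀ m o → ε (m ℕ.+ o) ≤ ε m
  go m zero    = ℚP.≤-reflexive-≡ (cong ε (ℕP.+-identityʳ m))
  go m (suc o) = ℚP.≤-trans (ℚP.≤-reflexive-≡ (cong ε (ℕP.+-suc m o)))
                            (ℚP.≤-trans (ε-suc≤ε (m ℕ.+ o)) (go m o))

ε[1+n]+ε[2+n]≤ε[n] : ∀ n → ε (suc n) + ε (suc (suc n)) ≤ ε n
ε[1+n]+ε[2+n]≤ε[n] n = ℚP.≤-trans (ℚP.+-monoʳ-≤ (ε (suc n)) (ε-suc≤ε (suc n))) (ℚP.≤-reflexive (ε-half n))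

ε-quarter : ∀ n → (ε (suc (suc n)) + ε (suc (suc n))) + (ε (suc (suc n)) + ε (suc (suc n))) ≤ ε n
ε-quarter n = ℚP.≤-reflexive (ℚP.≃-trans (ℚP.+-cong (ε-half (suc n)) (ε-half (suc n))) (ε-half n))

ε[2+n]+ε[2+n]≤ε[n] : ∀ n → ε (suc (suc n)) + ε (suc (suc n)) ≤ ε n
ε[2+n]+ε[2+n]≤ε[n] n = ℚP.≤-trans (ℚP.≤-reflexive (ε-half (suc n))) (ε-suc≤ε n)

private
  n≤pow2-1 : ∀ n → n ℕ.≤ pow2-1 n
  n≤pow2-1 zero    = ℕ.z≤n
  n≤pow2-1 (suc n) = ℕ.s≤s (ℕP.≤-trans (n≤pow2-1 n) (ℕP.m≤m+n _ _))

ε-below : ∀ t → 0ℚᵘ < t → Σ ℕ λ n → ε n < t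
ε-below (mkℚᵘ ℤ.+[1+ p ] q) _ = suc q , *<* (ℤ.+<+ (ℕ.s≤s (ℕ.s≤s
  (ℕP.≤-trans (ℕP.≤-reflexive (ℕP.+-identityʳ q))
  (ℕP.≤-trans (n≤pow2-1 q) (ℕP.≤-trans (ℕP.m≤m+n _ _) (ℕP.m≤m+n _ _)))))))
ε-below (mkℚᵘ (+ zero) q) (*<* (ℤ.+<+ ()))
ε-below (mkℚᵘ ℤ.-[1+ p ] q) (*<* ())

≤-by-ε : ∀ a b → (∀ n → a ≤ b + ε n) → a ≤ b
≤-by-ε a b a≤b+ε with a ℚP.≤? b
... | yes a≤b = a≤b
... | no a≰b = ⊥-elim (ℚP.<-irrefl ℚP.≃-refl (ℚP.≤-<-trans (a≤b+ε n) b+εn<a))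
  where
  0<a-b : 0ℚᵘ < a - b
  0<a-b = ℚP.<-respˡ-≃ (ℚP.+-inverseʳ b) (ℚP.+-monoˡ-< (- b) (ℚP.≰⇒> a≰b))
  n = proj₁ (ε-below (a - b) 0<a-b)
  eq : ∀ a b → b + (a - b) ≃ a
  eq = solve 2 (λ a b → b :+ (a :- b) := a) ℚP.≃-refl
  b+εn<a : b + ε n < a
  b+εn<a = ℚP.<-respʳ-≃ (eq a b) (ℚP.+-monoʳ-< b (proj₂ (ε-below (a - b) 0<a-b)))

-- Real numbers as regular sequences

regular-dist≤ : ∀ (x : ℝ) {a b} → a ℕ.≤ b → Dist (seq x a) (seq x b) (ε a)
regular-dist≤ x {a} a≤b with ℕP.m≤n⇒∃[o]m+o≡n a≤b
... | o , refl = dist-mono (telescope o) (≤-cancel (0≤ε (a ℕ.+ o)) (eq (ε a) (ε (a ℕ.+ o))))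
  where
  eq : ∀ A B → (A - B) + B ≃ A + 0ℚᵘ
  eq = solve 2 (λ A B → (A :- B) :+ B := A :+ con 0ℚᵘ) ℚP.≃-refl
  step : ∀ A B C → B ≃ C + C → (A - B) + C ≃ A - C
  step A B C B≃2C = ℚP.≃-trans (ℚP.+-congˡ C (ℚP.+-congʳ A (ℚP.-‿cong B≃2C))) (eq' A C)
    where
    eq' : ∀ A C → (A - (C + C)) + C ≃ A - C
    eq' = solve 2 (λ A C → (A :- (C :+ C)) :+ C := A :- C) ℚP.≃-refl
  telescope : ∀ d → Dist (seq x a) (seq x (a ℕ.+ d)) (ε a - ε (a ℕ.+ d))
  telescope zero rewrite ℕP.+-identityʳ a = dist-refl (seq x a) (ℚP.≤-reflexive (ℚP.≃-sym (ℚP.+-inverseʳ (ε a))))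
  telescope (suc d) rewrite ℕP.+-suc a d =
    dist-mono (dist-trans (telescope d) (dist (reg x (a ℕ.+ d))))
      (ℚP.≤-reflexive (step (ε a) (ε (a ℕ.+ d)) (ε (suc (a ℕ.+ d))) (ℚP.≃-sym (ε-half (a ℕ.+ d)))))

regular-dist : ∀ (x : ℝ) a b → Dist (seq x a) (seq x b) (ε a + ε b)
regular-dist x a b with ℕP.≤-total a b
... | inj₁ a≤b = dist-mono (regular-dist≤ x a≤b) (ℚP.p≤p+q (ε a) (ε b))
... | inj₂ b≤a = dist-mono (dist-sym (regular-dist≤ x b≤a)) (ℚP.p≤q+p (ε b) (ε a))

record Close (x y : Seq) (e : ℚᵘ) : Set where
  constructor close
  field close-at : ∀ n → Dist (x (suc (suc n))) (y (suc (suc n))) (e + ε n)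
open Close public

≤ʳ⇒close : ∀ {x y e} → absʳ (x -ʳ y) ≤ʳ constʳ e → Close x y e
≤ʳ⇒close h = close λ n → dist (h n)

close⇒≤ʳ : ∀ {x y e} → Close x y e → absʳ (x -ʳ y) ≤ʳ constʳ e
close⇒≤ʳ h n = ∣-∣≤ (close-at h n)

close-mono : ∀ {x y d e} → Close x y d → d ≤ e → Close x y e
close-mono h d≤e = close λ n → dist-mono (close-at h n) (ℚP.+-monoˡ-≤ (ε n) d≤e)

≃ʳ⇒close : ∀ {x y} → x ≃ʳ y → Close x y 0ℚᵘ
≃ʳ⇒close x≃y = close λ n → dist (ℚP.≤-trans (x≃y (suc n))
  (ℚP.≤-trans (ε-suc≤ε n) (ℚP.≤-reflexive (ℚP.≃-sym (ℚP.+-identityˡ (ε n))))))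

module _ (x y : ℝ) where

  close-from-index : ∀ L {d} → Dist (seq x L) (seq y L) d → Close (seq x) (seq y) (d + (ε L + ε L))
  close-from-index L {d} h = close λ n →
    dist-mono (dist-trans (dist-trans (regular-dist x (suc (suc n)) L) h) (regular-dist y L (suc (suc n))))
      (≤-cancel (ε[2+n]+ε[2+n]≤ε[n] n) (eq (ε (suc (suc n))) (ε L) d (ε n)))
    where
    eq : ∀ a b d c → (((a + b) + d) + (b + a)) + c ≃ ((d + (b + b)) + c) + (a + a)
    eq = solve 4 (λ a b d c → (((a :+ b) :+ d) :+ (b :+ a)) :+ c := ((d :+ (b :+ b)) :+ c) :+ (a :+ a)) ℚP.≃-refl

  close-dist : ∀ {e} → Close (seq x) (seq y) e → ∀ a b → Dist (seq x a) (seq y b) ((e + ε a) + ε b)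
  close-dist {e} h a b = dist (≤-by-ε _ _ λ n → ∣-∣≤ (dist-mono
    (dist-trans (dist-trans (regular-dist x a (3+ n)) (close-at h (suc n))) (regular-dist y (3+ n) b))
    (≤-cancel (slack n) (eq (ε a) (ε b) e (ε (suc n)) (ε (3+ n)) (ε n)))))
    where
    3+_ : ℕ → ℕ
    3+ n = suc (suc (suc n))
    slack : ∀ n → ε (suc n) + (ε (3+ n) + ε (3+ n)) ≤ ε n
    slack n = ℚP.≤-trans (ℚP.+-monoʳ-≤ (ε (suc n)) (ε[2+n]+ε[2+n]≤ε[n] (suc n))) (ℚP.≤-reflexive (ε-half n))
    eq : ∀ A B e c d f → ((A + d) + (e + c) + (d + B)) + f ≃ (((e + A) + B) + f) + (c + (d + d))
    eq = solve 6 (λ A B e c d f → ((A :+ d) :+ (e :+ c) :+ (d :+ B)) :+ f := (((e :+ A) :+ B) :+ f) :+ (c :+ (d :+ d))) ℚP.≃-refl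

close-trans : ∀ (x y z : ℝ) {d e} → Close (seq x) (seq y) d → Close (seq y) (seq z) e → Close (seq x) (seq z) (d + e)
close-trans x y z {d} {e} xy yz = close λ n →
  dist-mono (dist-trans (close-dist x y xy (suc (suc n)) (suc (suc n))) (close-dist y z yz (suc (suc n)) (suc (suc n))))
    (≤-cancel (ε-quarter n) (eq d e (ε (suc (suc n))) (ε n)))
  where
  eq : ∀ d e a c → (((d + a) + a) + ((e + a) + a)) + c ≃ ((d + e) + c) + ((a + a) + (a + a))
  eq = solve 4 (λ d e a c → (((d :+ a) :+ a) :+ ((e :+ a) :+ a)) :+ c := ((d :+ e) :+ c) :+ ((a :+ a) :+ (a :+ a))) ℚP.≃-refl

close-sym : ∀ {x y e} → Close x y e → Close y x e
close-sym {x} {y} {e} h = close λ n → dist-sym (close-at h n)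

constℝ : ℚᵘ → ℝ
constℝ a = mkℝ (constʳ a) (λ n → ∣-∣≤ (dist-refl a (0≤ε (suc n))))

dist⇒close-const : ∀ {a b e} → Dist a b e → Close (constʳ a) (constʳ b) e
dist⇒close-const {a} {b} {e} h = close λ n → dist-mono h (ℚP.p≤p+q e (ε n))

close-const⇒dist : ∀ {a b e} → Close (constʳ a) (constʳ b) e → Dist a b e
close-const⇒dist h = dist (≤-by-ε _ _ λ n → ∣-∣≤ (close-at h n))

-- Rational intervals

⊑-refl : ∀ {I : Interval} → I ⊑ I
⊑-refl {_ , _} = ℚP.≤-refl , ℚP.≤-refl

⊑-trans : ∀ {I J K : Interval} → I ⊑ J → J ⊑ K → I ⊑ K
⊑-trans {_ , _} {_ , _} {_ , _} (a , b) (c , d) = ℚP.≤-trans c a , ℚP.≤-trans b d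

≈ᴵ-sym : ∀ {I J : Interval} → I ≈ᴵ J → J ≈ᴵ I
≈ᴵ-sym {_ , _} {_ , _} (a , b) = b , a

≈ᴵ-mono : ∀ {I I' J J' : Interval} → I ⊑ I' → J ⊑ J' → I ≈ᴵ J → I' ≈ᴵ J'
≈ᴵ-mono {_ , _} {_ , _} {_ , _} {_ , _} (a , b) (c , d) (e , f) =
  ℚP.≤-trans c (ℚP.≤-trans e b) , ℚP.≤-trans a (ℚP.≤-trans f d)

width-mono : ∀ {I J : Interval} → I ⊑ J → width I ≤ width J
width-mono {_ , _} {_ , _} (p'≤p , q≤q') = ℚP.+-mono-≤ q≤q' (ℚP.neg-mono-≤ p'≤p)

width≤⇒≤+ : ∀ {p q w} → width (p , q) ≤ w → q ≤ p + w
width≤⇒≤+ {p} {q} {w} h = ≤-cancel h (eq q p w)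
  where
  eq : ∀ q p w → q + w ≃ (p + w) + (q - p)
  eq = solve 3 (λ q p w → q :+ w := (p :+ w) :+ (q :- p)) ℚP.≃-refl

ball : ℚᵘ → ℚᵘ → Interval
ball c r = c - r , c + r

width-ball : ∀ c r → width (ball c r) ≃ r + r
width-ball = solve 2 (λ c r → (c :+ r) :- (c :- r) := r :+ r) ℚP.≃-refl

dist⇒ball-≈ᴵ : ∀ {c c' r r'} → Dist c c' (r + r') → ball c r ≈ᴵ ball c' r'
dist⇒ball-≈ᴵ {c} {c'} {r} {r'} h =
  ≤-cancel (dist-≥ h) (eq₁ c c' r r') , ≤-cancel (dist-≤ h) (eq₂ c c' r r')
  where
  eq₁ : ∀ c c' r r' → (c' - r') + (c + (r + r')) ≃ (c + r) + c'
  eq₁ = solve 4 (λ c c' r r' → (c' :- r') :+ (c :+ (r :+ r')) := (c :+ r) :+ c') ℚP.≃-refl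
  eq₂ : ∀ c c' r r' → (c - r) + (c' + (r + r')) ≃ (c' + r') + c
  eq₂ = solve 4 (λ c c' r r' → (c :- r) :+ (c' :+ (r :+ r')) := (c' :+ r') :+ c) ℚP.≃-refl

meet : Interval → Interval → Interval
meet (a , b) (c , d) = a ⊔ c , b ⊓ d

meet-⊑ˡ : ∀ I J → meet I J ⊑ I
meet-⊑ˡ (a , b) (c , d) = ℚP.p≤p⊔q a c , ℚP.p⊓q≤p b d

meet-⊑ʳ : ∀ I J → meet I J ⊑ J
meet-⊑ʳ (a , b) (c , d) = ℚP.p≤q⊔p a c , ℚP.p⊓q≤q b d

meet-mono : ∀ {I I' J J'} → I ⊑ I' → J ⊑ J' → meet I J ⊑ meet I' J'
meet-mono {_ , _} {_ , _} {_ , _} {_ , _} (a , b) (c , d) = ℚP.⊔-mono-≤ a c , ℚP.⊓-mono-≤ b d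

-- Intersection, reading nothing as the whole line.
_⊓ᴹ_ : Maybe Interval → Maybe Interval → Maybe Interval
nothing ⊓ᴹ y      = y
just I  ⊓ᴹ nothing = just I
just I  ⊓ᴹ just J  = just (meet I J)

Refines-refl : ∀ x → Refines x x
Refines-refl nothing  = tt
Refines-refl (just I) = ⊑-refl

Refines-trans : ∀ x y z → Refines x y → Refines y z → Refines x z
Refines-trans x        y        nothing  _ _ = tt
Refines-trans (just X) (just Y) (just Z) h₁ h₂ = ⊑-trans h₁ h₂

Refines⇒Small : ∀ {k x J} → Refines x (just J) → width J ≤ ε k → Small k x
Refines⇒Small {x = just I} I⊑J wJ = ℚP.≤-trans (width-mono I⊑J) wJ

⊓ᴹ-refinesˡ : ∀ x y → Refines (x ⊓ᴹ y) x
⊓ᴹ-refinesˡ nothing  y        = tt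
⊓ᴹ-refinesˡ (just X) nothing  = ⊑-refl
⊓ᴹ-refinesˡ (just X) (just Y) = meet-⊑ˡ X Y

⊓ᴹ-refinesʳ : ∀ x y → Refines (x ⊓ᴹ y) y
⊓ᴹ-refinesʳ x        nothing  = tt
⊓ᴹ-refinesʳ nothing  (just Y) = ⊑-refl
⊓ᴹ-refinesʳ (just X) (just Y) = meet-⊑ʳ X Y

⊓ᴹ-mono : ∀ x x' y y' → Refines x x' → Refines y y' → Refines (x ⊓ᴹ y) (x' ⊓ᴹ y')
⊓ᴹ-mono x        nothing   y        nothing   _  _  = tt
⊓ᴹ-mono nothing  nothing   (just Y) (just Y') _  h₂ = h₂
⊓ᴹ-mono (just X) nothing   (just Y) (just Y') _  h₂ = ⊑-trans (meet-⊑ʳ X Y) h₂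
⊓ᴹ-mono (just X) (just X') nothing  nothing   h₁ _  = h₁
⊓ᴹ-mono (just X) (just X') (just Y) nothing   h₁ _  = ⊑-trans (meet-⊑ˡ X Y) h₁
⊓ᴹ-mono (just X) (just X') (just Y) (just Y') h₁ h₂ = meet-mono h₁ h₂

Compatible-sym : ∀ x y → Compatible x y → Compatible y x
Compatible-sym nothing  nothing  _ = tt
Compatible-sym nothing  (just _) _ = tt
Compatible-sym (just _) nothing  _ = tt
Compatible-sym (just I) (just J) h = ≈ᴵ-sym {I} {J} h

Compatible-⊓ᴹ : ∀ x y z → Compatible x z → Compatible y z → Compatible (x ⊓ᴹ y) z
Compatible-⊓ᴹ nothing        y              z              _ h = h
Compatible-⊓ᴹ (just I)       nothing        z              h _ = h
Compatible-⊓ᴹ (just _)       (just _)       nothing        _ _ = tt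
Compatible-⊓ᴹ (just (a , b)) (just (c , d)) (just (p , q)) (p≤b , a≤q) (p≤d , c≤q) =
  ℚP.⊓-glb p≤b p≤d , ℚP.⊔-lub a≤q c≤q

Compatible⇒InT : ∀ x → Compatible x x → InT x
Compatible⇒InT nothing  _ = tt
Compatible⇒InT (just _) h = proj₁ h


_∈ᴵ_ : Seq → Interval → Set
z ∈ᴵ I = ∀ M → (proj₁ I ≤ z (suc (suc M)) + ε M) × (z (suc (suc M)) ≤ proj₂ I + ε M)

_∈ᴹ_ : Seq → Maybe Interval → Set
z ∈ᴹ nothing = ⊤
z ∈ᴹ just I  = z ∈ᴵ I

∈ᴵ-meet : ∀ {z} I J → z ∈ᴵ I → z ∈ᴵ J → z ∈ᴵ meet I J
∈ᴵ-meet (a , b) (c , d) z∈I z∈J M =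
  ℚP.⊔-lub (proj₁ (z∈I M)) (proj₁ (z∈J M)) ,
  ℚP.≤-respʳ-≃ (ℚP.≃-sym (ℚP.mono-≤-distrib-⊓ (ℚP.+-monoˡ-≤ (ε M)) b d))
               (ℚP.⊓-glb (proj₂ (z∈I M)) (proj₂ (z∈J M)))

∈ᴹ-⊓ᴹ : ∀ {z} x y → z ∈ᴹ x → z ∈ᴹ y → z ∈ᴹ (x ⊓ᴹ y)
∈ᴹ-⊓ᴹ     nothing  y        _   z∈y = z∈y
∈ᴹ-⊓ᴹ     (just I) nothing  z∈x _   = z∈x
∈ᴹ-⊓ᴹ {z} (just I) (just J) z∈x z∈y = ∈ᴵ-meet {z} I J z∈x z∈y

∈ᴵ⇒close-left : ∀ {z p q w} → z ∈ᴵ (p , q) → width (p , q) ≤ w → 0ℚᵘ ≤ w → Close z (constʳ p) w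
∈ᴵ⇒close-left {z} {p} {q} {w} z∈I wI 0≤w = close λ M → dist-intro
  (ℚP.≤-trans (proj₂ (z∈I M))
     (ℚP.≤-trans (ℚP.+-monoˡ-≤ (ε M) (width≤⇒≤+ {p} {q} wI)) (ℚP.≤-reflexive (ℚP.+-assoc p w (ε M)))))
  (ℚP.≤-trans (proj₁ (z∈I M)) (ℚP.+-monoʳ-≤ (z (suc (suc M))) (ℚP.p≤q+p (ε M) w {{nonNegative 0≤w}})))

∈ᴵ-close : ∀ (za zb : ℝ) {I J w} → seq za ∈ᴵ I → seq zb ∈ᴵ J → I ≈ᴵ J →
           width I ≤ w → width J ≤ w → 0ℚᵘ ≤ w → Close (seq za) (seq zb) ((w + w) + w)
∈ᴵ-close za zb {pa , qa} {pb , qb} {w} za∈I zb∈J (pb≤qa , pa≤qb) wI wJ 0≤w =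
  close-trans za (constℝ pb) zb
    (close-trans za (constℝ pa) (constℝ pb) (∈ᴵ⇒close-left {q = qa} za∈I wI 0≤w) (dist⇒close-const pa~pb))
    (close-sym (∈ᴵ⇒close-left {q = qb} zb∈J wJ 0≤w))
  where
  pa~pb : Dist pa pb w
  pa~pb = dist-intro (ℚP.≤-trans pa≤qb (width≤⇒≤+ {pb} wJ)) (ℚP.≤-trans pb≤qa (width≤⇒≤+ {pa} wI))

∈ᴹ-intro : ∀ {z} x → (∀ {I} → x ≡ just I → z ∈ᴵ I) → z ∈ᴹ x
∈ᴹ-intro nothing  _   = tt
∈ᴹ-intro (just I) z∈I = z∈I refl

∈ᴹ-close : ∀ (za zb : ℝ) {k} x y → Small k x → Small k y → Compatible x y →
           seq za ∈ᴹ x → seq zb ∈ᴹ y → Close (seq za) (seq zb) ((ε k + ε k) + ε k)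
∈ᴹ-close za zb {k} (just I) (just J) wI wJ I≈J za∈I zb∈J = ∈ᴵ-close za zb za∈I zb∈J I≈J wI wJ (0≤ε k)

∈ᴵ⇒dist-left : ∀ (z : ℝ) I → seq z ∈ᴵ I → ∀ K → width I ≤ ε (suc (suc K)) → Dist (seq z (suc K)) (proj₁ I) (ε K)
∈ᴵ⇒dist-left z (p , q) z∈I K wI =
  dist-mono (close-dist z (constℝ p) (∈ᴵ⇒close-left {q = q} z∈I wI (0≤ε (suc (suc K)))) (suc K) (suc (suc K)))
    (ℚP.≤-reflexive (ℚP.≃-trans (eq (ε (suc (suc K))) (ε (suc K)))
                                (ℚP.≃-trans (ℚP.+-congʳ (ε (suc K)) (ε-half (suc K))) (ε-half K))))
  where
  eq : ∀ a b → (a + b) + a ≃ b + (a + a)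
  eq = solve 2 (λ a b → (a :+ b) :+ a := b :+ (a :+ a)) ℚP.≃-refl

dist⇒∈ᴵ-ball : ∀ {z c r} → (∀ M → Dist (z (suc (suc M))) c (r + ε M)) → z ∈ᴵ ball c r
dist⇒∈ᴵ-ball {z} {c} {r} h M =
  ≤-cancel (dist-≥ (h M)) (eq₁ (z (suc (suc M))) c r (ε M)) ,
  ℚP.≤-trans (dist-≤ (h M)) (ℚP.≤-reflexive (ℚP.≃-sym (ℚP.+-assoc c r (ε M))))
  where
  eq₁ : ∀ x c r e → (c - r) + (x + (r + e)) ≃ (x + e) + c
  eq₁ = solve 4 (λ x c r e → (c :- r) :+ (x :+ (r :+ e)) := (x :+ e) :+ c) ℚP.≃-refl

-- The ternary tree

pattern lower  = zero
pattern middle = suc zero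
pattern upper  = suc (suc zero)

length-∷ʳ : ∀ (s : Seq3) i → length (s ∷ʳ i) ≡ suc (length s)
length-∷ʳ s i = trans (LP.length-++ s) (ℕP.+-comm (length s) 1)

length-prefix : ∀ α n → length (prefix α n) ≡ n
length-prefix α zero    = refl
length-prefix α (suc n) = trans (length-∷ʳ (prefix α n) (α n)) (cong suc (length-prefix α n))

prefix-suc : ∀ α n → prefix α (suc n) ≡ α 0 ∷ prefix (λ i → α (suc i)) n
prefix-suc α zero    = refl
prefix-suc α (suc n) = cong (_∷ʳ α (suc n)) (prefix-suc α n)

take-++ˡ : ∀ {A : Set} m (xs ys : List A) → m ℕ.≤ length xs → take m (xs ++ ys) ≡ take m xs
take-++ˡ zero    xs       ys _           = refl
take-++ˡ (suc m) (x ∷ xs) ys (ℕ.s≤s m≤) = cong (x ∷_) (take-++ˡ m xs ys m≤)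

length-take≤ : ∀ {A : Set} m (xs : List A) → m ℕ.≤ length xs → length (take m xs) ≡ m
length-take≤ m xs m≤ = trans (LP.length-take m xs) (ℕP.m≤n⇒m⊓n≡m m≤)

take-prefix : ∀ α {m} n → m ℕ.≤ n → take m (prefix α n) ≡ prefix α m
take-prefix α {m} n m≤n with ℕP.m≤n⇒m<n∨m≡n m≤n
... | inj₂ refl = LP.take-all m (prefix α m) (ℕP.≤-reflexive (length-prefix α m))
take-prefix α {m} (suc n) _ | inj₁ (ℕ.s≤s m≤n) =
  trans (take-++ˡ m (prefix α n) (α n ∷ []) (ℕP.≤-trans m≤n (ℕP.≤-reflexive (sym (length-prefix α n)))))
        (take-prefix α n m≤n)

padded : Seq3 → ℕ → Fin 3
padded []      i       = middle
padded (x ∷ u) zero    = x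
padded (x ∷ u) (suc i) = padded u i

prefix-padded : ∀ u → prefix (padded u) (length u) ≡ u
prefix-padded []      = refl
prefix-padded (x ∷ u) = trans (prefix-suc (padded (x ∷ u)) (length u)) (cong (x ∷_) (prefix-padded u))

padded-beyond : ∀ u m → padded u (length u ℕ.+ m) ≡ middle
padded-beyond []      m = refl
padded-beyond (x ∷ u) m = padded-beyond u m

prefix-padded-+ : ∀ u m → prefix (padded u) (length u ℕ.+ m) ≡ u ++ replicate m middle
prefix-padded-+ u zero rewrite ℕP.+-identityʳ (length u) | LP.++-identityʳ u = prefix-padded u
prefix-padded-+ u (suc m) rewrite ℕP.+-suc (length u) m | prefix-padded-+ u m | padded-beyond u m =
  trans (LP.++-assoc u (replicate m middle) (middle ∷ [])) (cong (u ++_) (replicate-∷ʳ m))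
  where
  replicate-∷ʳ : ∀ m → replicate m middle ∷ʳ middle ≡ middle ∷ replicate m middle
  replicate-∷ʳ zero    = refl
  replicate-∷ʳ (suc m) = cong (middle ∷_) (replicate-∷ʳ m)

dyadic : Seq3 → ℕ → ℚᵘ
dyadic s n = mkℚᵘ (N s) (pow2-1 (suc n))

centre : Seq3 → ℚᵘ
centre s = dyadic s (length s)

radius : Seq3 → ℚᵘ
radius s = ε (suc (length s))

private
  dyadic-refine : ∀ s n → dyadic s n ≃ mkℚᵘ (+ 2 ℤ.* N s) (pow2-1 (suc (suc n)))
  dyadic-refine s n = mkℚᵘ-scale (N s) 1 (pow2-1 (suc n)) (pow2-1 (suc (suc n))) (pow2-step (suc n))

dyadic-∷ʳ-lower : ∀ s n → dyadic (s ∷ʳ lower) (suc n) + ε (suc (suc n)) ≃ dyadic s n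
dyadic-∷ʳ-lower s n rewrite N-step s lower =
  ℚP.≃-trans (+-sameDenominator (stepZ (N s) lower) (+ 1) (pow2-1 (suc (suc n))))
    (ℚP.≃-trans (ℚP.≃-reflexive (cong (λ a → mkℚᵘ a (pow2-1 (suc (suc n)))) (eq (N s))))
                (ℚP.≃-sym (dyadic-refine s n)))
  where
  eq : ∀ a → (+ 2 ℤ.* a ℤ.+ (+ 0 ℤ.- + 1)) ℤ.+ + 1 ≡ + 2 ℤ.* a
  eq = ℤSolver.solve-∀

dyadic-∷ʳ-middle : ∀ s n → dyadic (s ∷ʳ middle) (suc n) ≃ dyadic s n
dyadic-∷ʳ-middle s n rewrite N-step s middle =
  ℚP.≃-sym (ℚP.≃-trans (dyadic-refine s n) (ℚP.≃-reflexive (cong (λ a → mkℚᵘ a (pow2-1 (suc (suc n)))) (eq (N s)))))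
  where
  eq : ∀ a → + 2 ℤ.* a ≡ + 2 ℤ.* a ℤ.+ (+ 1 ℤ.- + 1)
  eq = ℤSolver.solve-∀

dyadic-∷ʳ-upper : ∀ s n → dyadic (s ∷ʳ upper) (suc n) ≃ dyadic s n + ε (suc (suc n))
dyadic-∷ʳ-upper s n rewrite N-step s upper =
  ℚP.≃-sym (ℚP.≃-trans (ℚP.+-congˡ (ε (suc (suc n))) (dyadic-refine s n))
    (ℚP.≃-trans (+-sameDenominator (+ 2 ℤ.* N s) (+ 1) (pow2-1 (suc (suc n))))
      (ℚP.≃-reflexive (cong (λ a → mkℚᵘ a (pow2-1 (suc (suc n)))) (eq (N s))))))
  where
  eq : ∀ a → + 2 ℤ.* a ℤ.+ + 1 ≡ + 2 ℤ.* a ℤ.+ (+ 2 ℤ.- + 1)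
  eq = ℤSolver.solve-∀

Φ-padded : ∀ u {L} → length u ℕ.≤ L → Φseq (padded u) L ≃ centre u
Φ-padded u {L} |u|≤L with ℕP.m≤n⇒∃[o]m+o≡n |u|≤L
... | m , refl rewrite prefix-padded-+ u m = pad m u (length u)
  where
  pad : ∀ m u n → dyadic (u ++ replicate m middle) (n ℕ.+ m) ≃ dyadic u n
  pad zero u n rewrite ℕP.+-identityʳ n | LP.++-identityʳ u = ℚP.≃-refl
  pad (suc m) u n rewrite ℕP.+-suc n m | sym (LP.++-assoc u (middle ∷ []) (replicate m middle)) =
    ℚP.≃-trans (pad m (u ∷ʳ middle) (suc n)) (dyadic-∷ʳ-middle u n)

mkℚᵘ-pred+1 : ∀ a d → mkℚᵘ (a ℤ.- + 1) d + mkℚᵘ (+ 1) d ≃ mkℚᵘ a d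
mkℚᵘ-pred+1 a d = ℚP.≃-trans (+-sameDenominator (a ℤ.- + 1) (+ 1) d)
  (ℚP.≃-reflexive (cong (λ a → mkℚᵘ a d) (eq a)))
  where
  eq : ∀ a → (a ℤ.- + 1) ℤ.+ + 1 ≡ a
  eq = ℤSolver.solve-∀

𝕀-left+radius : ∀ s → proj₁ (𝕀 s) + radius s ≃ centre s
𝕀-left+radius s = mkℚᵘ-pred+1 (N s) (pow2-1 (suc (length s)))

𝕀-right : ∀ s → proj₂ (𝕀 s) ≃ centre s + radius s
𝕀-right s = ℚP.≃-sym (+-sameDenominator (N s) (+ 1) (pow2-1 (suc (length s))))

𝕀-self : ∀ s → 𝕀 s ≈ᴵ 𝕀 s
𝕀-self s = left≤right , left≤right
  where
  left≤right : proj₁ (𝕀 s) ≤ proj₂ (𝕀 s)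
  left≤right = mkℚᵘ-mono-≤ (pow2-1 (suc (length s))) (ℤP.+-monoʳ-≤ (N s) (ℤ.-≤+ {0} {1}))

𝕀-≈ᴵ⇒dist : ∀ u v → 𝕀 u ≈ᴵ 𝕀 v → Dist (centre u) (centre v) (radius u + radius v)
𝕀-≈ᴵ⇒dist u v (lv≤ru , lu≤rv) = dist-intro
  (≤-cancel lu≤rv (ℚP.≃-trans (ℚP.+-cong (ℚP.≃-sym (𝕀-left+radius u)) (𝕀-right v))
                              (eq₁ (proj₁ (𝕀 u)) (radius u) (centre v) (radius v))))
  (≤-cancel lv≤ru (ℚP.≃-trans (ℚP.+-cong (ℚP.≃-sym (𝕀-left+radius v)) (𝕀-right u))
                              (eq₂ (proj₁ (𝕀 v)) (radius v) (centre u) (radius u))))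
  where
  eq₁ : ∀ a h c k → (a + h) + (c + k) ≃ (c + (h + k)) + a
  eq₁ = solve 4 (λ a h c k → (a :+ h) :+ (c :+ k) := (c :+ (h :+ k)) :+ a) ℚP.≃-refl
  eq₂ : ∀ a h c k → (a + h) + (c + k) ≃ (c + (k + h)) + a
  eq₂ = solve 4 (λ a h c k → (a :+ h) :+ (c :+ k) := (c :+ (k :+ h)) :+ a) ℚP.≃-refl

private
  grid : ∀ a b n → mkℚᵘ a (pow2-1 (suc n)) ≤ mkℚᵘ b (pow2-1 (suc n)) + ε (suc (suc n)) → a ℤ.≤ b
  grid a b n hyp with a ℤP.≤? b
  ... | yes a≤b = a≤b
  ... | no a≰b = ⊥-elim (ℚP.<⇒≱ (ε-suc<ε (suc n))
                          (≤-cancel (ℚP.≤-trans b+1≤a hyp) (eq (ε (suc n)) (ε (suc (suc n))) (mkℚᵘ b D))))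
    where
    D = pow2-1 (suc n)
    b+1≤a : mkℚᵘ b D + ε (suc n) ≤ mkℚᵘ a D
    b+1≤a = ℚP.≤-respˡ-≃ (ℚP.≃-sym (ℚP.≃-trans (+-sameDenominator b (+ 1) D)
                                               (ℚP.≃-reflexive (cong (λ z → mkℚᵘ z D) (ℤP.+-comm b (+ 1))))))
                         (mkℚᵘ-mono-≤ D (ℤP.i<j⇒suc[i]≤j (ℤP.≰⇒> a≰b)))
    eq : ∀ x y B → x + (B + y) ≃ y + (B + x)
    eq = solve 3 (λ x y B → x :+ (B :+ y) := y :+ (B :+ x)) ℚP.≃-refl

  left≤right : ∀ a b n → mkℚᵘ a (pow2-1 (suc n)) ≤ mkℚᵘ b (pow2-1 (suc n)) + (ε n + ε (suc (suc n))) →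
               mkℚᵘ (a ℤ.- + 1) (pow2-1 (suc n)) ≤ mkℚᵘ (b ℤ.+ + 1) (pow2-1 (suc n))
  left≤right a b n a≤b+ = mkℚᵘ-mono-≤ D (grid (a ℤ.- + 1) (b ℤ.+ + 1) n
    (≤-cancel (ℚP.+-mono-≤ (ℚP.+-mono-≤ (ℚP.+-mono-≤ a≤b+ (ℚP.≤-reflexive la+1≃ca)) (ℚP.≤-reflexive rb≃cb+1))
                           (ℚP.≤-reflexive (ℚP.≃-sym (ε-half n))))
              (eq la rb e₂ ca e₁ cb (ε n))))
    where
    D = pow2-1 (suc n)
    la = mkℚᵘ (a ℤ.- + 1) D
    rb = mkℚᵘ (b ℤ.+ + 1) D
    ca = mkℚᵘ a D
    cb = mkℚᵘ b D
    e₁ = ε (suc n)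
    e₂ = ε (suc (suc n))
    la+1≃ca : la + e₁ ≃ ca
    la+1≃ca = mkℚᵘ-pred+1 a D
    rb≃cb+1 : cb + e₁ ≃ rb
    rb≃cb+1 = +-sameDenominator b (+ 1) D
    eq : ∀ la rb e₂ ca e₁ cb en →
         la + ((cb + (en + e₂)) + ca + rb + (e₁ + e₁)) ≃ (rb + e₂) + (ca + (la + e₁) + (cb + e₁) + en)
    eq = solve 7 (λ la rb e₂ ca e₁ cb en →
      la :+ ((cb :+ (en :+ e₂)) :+ ca :+ rb :+ (e₁ :+ e₁)) := (rb :+ e₂) :+ (ca :+ (la :+ e₁) :+ (cb :+ e₁) :+ en)) ℚP.≃-refl

dist⇒𝕀-≈ᴵ : ∀ s t n → length s ≡ n → length t ≡ n →
            Dist (dyadic s n) (dyadic t n) (ε n + ε (suc (suc n))) → 𝕀 s ≈ᴵ 𝕀 t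
dist⇒𝕀-≈ᴵ s t _ refl |t|≡|s| h =
  subst (λ m → 𝕀 s ≈ᴵ (mkℚᵘ (N t ℤ.- + 1) (pow2-1 (suc m)) , mkℚᵘ (N t ℤ.+ + 1) (pow2-1 (suc m))))
        (sym |t|≡|s|)
        (left≤right (N t) (N s) (length s) (dist-≥ h) , left≤right (N s) (N t) (length s) (dist-≤ h))

𝕀-∷ʳ : ∀ s i → 𝕀 (s ∷ʳ i) ⊑ 𝕀 s
𝕀-∷ʳ s i rewrite length-∷ʳ s i | N-step s i =
  ℚP.≤-respˡ-≃ (ℚP.≃-sym (mkℚᵘ-scale (N s ℤ.- + 1) 1 D D' D'≡2D)) (mkℚᵘ-mono-≤ D' (lower-end (N s) i)) ,
  ℚP.≤-respʳ-≃ (ℚP.≃-sym (mkℚᵘ-scale (N s ℤ.+ + 1) 1 D D' D'≡2D)) (mkℚᵘ-mono-≤ D' (upper-end (N s) i))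
  where
  D = pow2-1 (suc (length s))
  D' = pow2-1 (suc (suc (length s)))
  D'≡2D = pow2-step (suc (length s))
  digit≤2 : ∀ (i : Fin 3) → + toℕ i ℤ.≤ + 2
  digit≤2 lower  = ℤ.+≤+ ℕ.z≤n
  digit≤2 middle = ℤ.+≤+ (ℕ.s≤s ℕ.z≤n)
  digit≤2 upper  = ℤ.+≤+ (ℕ.s≤s (ℕ.s≤s ℕ.z≤n))
  lower-end : ∀ a i → + 2 ℤ.* (a ℤ.- + 1) ℤ.≤ stepZ a i ℤ.- + 1
  lower-end a i = ℤP.≤-trans (ℤP.i≤i+j (+ 2 ℤ.* (a ℤ.- + 1)) (+ toℕ i)) (ℤP.≤-reflexive (eq a (+ toℕ i)))
    where
    eq : ∀ a t → + 2 ℤ.* (a ℤ.- + 1) ℤ.+ t ≡ (+ 2 ℤ.* a ℤ.+ (t ℤ.- + 1)) ℤ.- + 1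
    eq = ℤSolver.solve-∀
  upper-end : ∀ a i → stepZ a i ℤ.+ + 1 ℤ.≤ + 2 ℤ.* (a ℤ.+ + 1)
  upper-end a i = ℤP.≤-trans (ℤP.≤-reflexive (eq₁ a (+ toℕ i)))
    (ℤP.≤-trans (ℤP.+-monoʳ-≤ (+ 2 ℤ.* a) (digit≤2 i)) (ℤP.≤-reflexive (eq₂ a)))
    where
    eq₁ : ∀ a t → (+ 2 ℤ.* a ℤ.+ (t ℤ.- + 1)) ℤ.+ + 1 ≡ + 2 ℤ.* a ℤ.+ t
    eq₁ = ℤSolver.solve-∀
    eq₂ : ∀ a → + 2 ℤ.* a ℤ.+ + 2 ≡ + 2 ℤ.* (a ℤ.+ + 1)
    eq₂ = ℤSolver.solve-∀

𝕀-++ : ∀ t s → 𝕀 (s ++ t) ⊑ 𝕀 s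
𝕀-++ []      s rewrite LP.++-identityʳ s = ⊑-refl
𝕀-++ (x ∷ t) s rewrite sym (LP.++-assoc s (x ∷ []) t) = ⊑-trans (𝕀-++ t (s ∷ʳ x)) (𝕀-∷ʳ s x)

𝕀-take : ∀ m s → 𝕀 s ⊑ 𝕀 (take m s)
𝕀-take m s = subst (λ u → 𝕀 u ⊑ 𝕀 (take m s)) (LP.take++drop≡id m s) (𝕀-++ (drop m s) (take m s))

μ≤-spec : {P : ℕ → Set} (P? : Decidable P) → ∀ B → P B → P (μ≤ P? B)
μ≤-spec {P} P? = search 0
  where
  search : ∀ i b → P (i ℕ.+ b) → P (searchFrom P? i b)
  search i zero    p = subst P (ℕP.+-identityʳ i) p
  search i (suc b) p with P? i
  ... | yes q = q
  ... | no _  = search (suc i) b (subst P (ℕP.+-suc i b) p)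

Small⇒just : ∀ {k} m → Small k m → Σ Interval λ I → (m ≡ just I) × (width I ≤ ε k)
Small⇒just (just I) w = I , refl , w

h-spec : ∀ c k α → Small k (φ c (prefix α (h c k α)))
h-spec c k α = μ≤-spec (λ n → Small? k (φ c (prefix α n))) (proj₁ (c2 c k α)) (proj₂ (c2 c k α))

fT-spec : ∀ c α k → Σ Interval λ I → (φ c (prefix α (h c k α)) ≡ just I) × (fT c α k ≡ I) × (width I ≤ ε k)
fT-spec c α k with Small⇒just (φ c (prefix α (h c k α))) (h-spec c k α)
... | I , e , w rewrite e = I , refl , refl , w

fT-width : ∀ c α k → width (fT c α k) ≤ ε k
fT-width c α k with fT-spec c α k
... | _ , _ , fT≡I , w rewrite fT≡I = w

δ-spec : ∀ c α k → width (fT c α (δ (fT c α) k)) ≤ ε (suc k)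
δ-spec c α k = μ≤-spec (λ n → width (fT c α n) ℚP.≤? ε (suc k)) (suc k) (fT-width c α (suc k))

determined-spec : ∀ c α k → Σ Interval λ I →
  (φ c (prefix α (h c (δ (fT c α) k) α)) ≡ just I) × (width I ≤ ε (suc k)) × (determined (fT c α) k ≡ proj₁ I)
determined-spec c α k with fT-spec c α (δ (fT c α) k)
... | I , φ≡I , fT≡I , _ = I , φ≡I , subst (λ J → width J ≤ ε (suc k)) fT≡I (δ-spec c α k) , cong proj₁ fT≡I

-- Digits are chosen so that x stays within 2⁻⁽ⁿ⁺¹⁾ of the n-th dyadic approximation; since the
-- three child intervals overlap, comparing rational approximations of x always finds one.
module TernaryExpansion (x : Pt01) where
  private
    xs : Seq
    xs = seq (pt x)

    3+_ : ℕ → ℕ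
    3+ n = suc (suc (suc n))

  Approximates : Seq3 → ℕ → Set
  Approximates s n = ∀ m → Dist (xs (suc m)) (dyadic s n) (ε (suc n) + ε m)

  digit : ℕ → Seq3 → Fin 3
  digit n s with xs (3+ n) + ε (3+ n) ℚP.<? dyadic s n | dyadic s n + ε (3+ n) ℚP.<? xs (3+ n)
  ... | yes _ | _     = lower
  ... | no _  | yes _ = upper
  ... | no _  | no _  = middle

  approximates-[] : Approximates [] zero
  approximates-[] m = dist-intro
    (≤-cancel (hi x m) (eq₁ (xs (suc m)) (ε 1) (ε m) 1ℚᵘ (ε-half 0)))
    (≤-cancel (lo x m) (eq₂ (xs (suc m)) (ε 1) (ε m)))
    where
    eq₁ : ∀ X e₁ em one → e₁ + e₁ ≃ one → X + (one + em) ≃ (e₁ + (e₁ + em)) + X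
    eq₁ X e₁ em one e = ℚP.≃-trans (ℚP.+-congʳ X (ℚP.+-congˡ em (ℚP.≃-sym e))) (eq X e₁ em)
      where
      eq : ∀ X e₁ em → X + ((e₁ + e₁) + em) ≃ (e₁ + (e₁ + em)) + X
      eq = solve 3 (λ X e₁ em → X :+ ((e₁ :+ e₁) :+ em) := (e₁ :+ (e₁ :+ em)) :+ X) ℚP.≃-refl
    eq₂ : ∀ X e₁ em → e₁ + (X + em) ≃ (X + (e₁ + em)) + 0ℚᵘ
    eq₂ = solve 3 (λ X e₁ em → e₁ :+ (X :+ em) := (X :+ (e₁ :+ em)) :+ con 0ℚᵘ) ℚP.≃-refl

  module _ (n : ℕ) (s : Seq3) (approx : Approximates s n) where
    private
      c = dyadic s n
      q = xs (3+ n)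
      t = ε (3+ n)
      e₁ = ε (suc n)
      e₂ = ε (suc (suc n))

    approximates-lower : q + t < c → Approximates (s ∷ʳ lower) (suc n)
    approximates-lower lt m = dist-intro upper-bound lower-bound
      where
      c' = dyadic (s ∷ʳ lower) (suc n)
      X = xs (suc m)
      upper-bound : X ≤ c' + (e₂ + ε m)
      upper-bound = ≤-cancel
        (ℚP.+-mono-≤ (ℚP.+-mono-≤ (ℚP.+-mono-≤ (dist-≤ (regular-dist (pt x) (suc m) (3+ n))) (ℚP.<⇒≤ lt)) (ε-suc≤ε m))
                     (ℚP.≤-reflexive (ℚP.≃-sym (dyadic-∷ʳ-lower s n))))
        (eq X q t (ε (suc m)) c (ε m) c' e₂)
        where
        eq : ∀ X q t e c em c' e₂ → X + ((q + (e + t)) + c + em + (c' + e₂)) ≃ (c' + (e₂ + em)) + (X + (q + t) + e + c)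
        eq = solve 8 (λ X q t e c em c' e₂ →
          X :+ ((q :+ (e :+ t)) :+ c :+ em :+ (c' :+ e₂)) := (c' :+ (e₂ :+ em)) :+ (X :+ (q :+ t) :+ e :+ c)) ℚP.≃-refl
      lower-bound : c' ≤ X + (e₂ + ε m)
      lower-bound = ≤-cancel
        (ℚP.+-mono-≤ (ℚP.+-mono-≤ (dist-≥ (approx m)) (ℚP.≤-reflexive (dyadic-∷ʳ-lower s n)))
                     (ℚP.≤-reflexive (ℚP.≃-sym (ε-half (suc n)))))
        (eq c' X e₁ (ε m) c e₂)
        where
        eq : ∀ c' X e₁ em c e₂ → c' + ((X + (e₁ + em)) + c + (e₂ + e₂)) ≃ (X + (e₂ + em)) + (c + (c' + e₂) + e₁)
        eq = solve 6 (λ c' X e₁ em c e₂ →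
          c' :+ ((X :+ (e₁ :+ em)) :+ c :+ (e₂ :+ e₂)) := (X :+ (e₂ :+ em)) :+ (c :+ (c' :+ e₂) :+ e₁)) ℚP.≃-refl

    approximates-middle : ¬ (q + t < c) → ¬ (c + t < q) → Approximates (s ∷ʳ middle) (suc n)
    approximates-middle q+t≮c c+t≮q m = dist-cong ℚP.≃-refl (ℚP.≃-sym (dyadic-∷ʳ-middle s n))
      (dist-mono (dist-trans (regular-dist (pt x) (suc m) (3+ n)) (dist-intro (ℚP.≮⇒≥ c+t≮q) (ℚP.≮⇒≥ q+t≮c)))
        (≤-cancel (ℚP.+-mono-≤ (ε-suc≤ε m) (ℚP.≤-reflexive (ε-half (suc (suc n))))) (eq (ε (suc m)) t (ε m) e₂)))
      where
      eq : ∀ a b c d → ((a + b) + b) + (c + d) ≃ (d + c) + (a + (b + b))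
      eq = solve 4 (λ a b c d → ((a :+ b) :+ b) :+ (c :+ d) := (d :+ c) :+ (a :+ (b :+ b))) ℚP.≃-refl

    approximates-upper : c + t < q → Approximates (s ∷ʳ upper) (suc n)
    approximates-upper lt m = dist-intro upper-bound lower-bound
      where
      c' = dyadic (s ∷ʳ upper) (suc n)
      X = xs (suc m)
      lower-bound : c' ≤ X + (e₂ + ε m)
      lower-bound = ≤-cancel
        (ℚP.+-mono-≤ (ℚP.+-mono-≤ (ℚP.+-mono-≤ (ℚP.≤-reflexive (dyadic-∷ʳ-upper s n)) (ℚP.<⇒≤ lt))
                                  (dist-≥ (regular-dist (pt x) (suc m) (3+ n)))) (ε-suc≤ε m))
        (eq c' c e₂ q X (ε (suc m)) t (ε m))
        where
        eq : ∀ c' c e₂ q X e t em → c' + ((c + e₂) + q + (X + (e + t)) + em) ≃ (X + (e₂ + em)) + (c' + (c + t) + q + e)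
        eq = solve 8 (λ c' c e₂ q X e t em →
          c' :+ ((c :+ e₂) :+ q :+ (X :+ (e :+ t)) :+ em) := (X :+ (e₂ :+ em)) :+ (c' :+ (c :+ t) :+ q :+ e)) ℚP.≃-refl
      upper-bound : X ≤ c' + (e₂ + ε m)
      upper-bound = ≤-cancel
        (ℚP.+-mono-≤ (ℚP.+-mono-≤ (dist-≤ (approx m)) (ℚP.≤-reflexive (ℚP.≃-sym (dyadic-∷ʳ-upper s n))))
                     (ℚP.≤-reflexive (ℚP.≃-sym (ε-half (suc n)))))
        (eq X c e₁ (ε m) c' e₂)
        where
        eq : ∀ X c e₁ em c' e₂ → X + ((c + (e₁ + em)) + c' + (e₂ + e₂)) ≃ (c' + (e₂ + em)) + (X + (c + e₂) + e₁)
        eq = solve 6 (λ X c e₁ em c' e₂ →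
          X :+ ((c :+ (e₁ :+ em)) :+ c' :+ (e₂ :+ e₂)) := (c' :+ (e₂ :+ em)) :+ (X :+ (c :+ e₂) :+ e₁)) ℚP.≃-refl

    approximates-digit : Approximates (s ∷ʳ digit n s) (suc n)
    approximates-digit with q + t ℚP.<? c | c + t ℚP.<? q
    ... | yes lt    | _         = approximates-lower lt
    ... | no q+t≮c  | yes lt    = approximates-upper lt
    ... | no q+t≮c  | no c+t≮q  = approximates-middle q+t≮c c+t≮q

  digits : ℕ → Seq3
  digits zero    = []
  digits (suc n) = digits n ∷ʳ digit n (digits n)

  expansion : ℕ → Fin 3
  expansion n = digit n (digits n)

  approximates-digits : ∀ n → Approximates (digits n) n
  approximates-digits zero    = approximates-[]
  approximates-digits (suc n) = approximates-digit n (digits n) (approximates-digits n)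

  prefix-expansion : ∀ n → prefix expansion n ≡ digits n
  prefix-expansion zero    = refl
  prefix-expansion (suc n) = cong (_∷ʳ expansion n) (prefix-expansion n)

  Φ-expansion-approximates : ∀ n m → Dist (xs (suc m)) (Φseq expansion n) (ε (suc n) + ε m)
  Φ-expansion-approximates n m =
    subst (λ s → Dist (xs (suc m)) (dyadic s n) (ε (suc n) + ε m)) (sym (prefix-expansion n)) (approximates-digits n m)

  close-Φ-expansion : ∀ n → Close xs (constʳ (Φseq expansion n)) (ε (suc n))
  close-Φ-expansion n = close λ m →
    dist-mono (Φ-expansion-approximates n (suc m)) (ℚP.+-monoʳ-≤ (ε (suc n)) (ε-suc≤ε m))

  ≃-Φ-expansion : xs ≃ʳ Φseq expansion
  ≃-Φ-expansion K = ≤-by-ε _ _ λ p → ∣-∣≤ (dist-mono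
    (dist-trans (regular-dist≤ (pt x) (ℕ.s≤s (ℕP.m≤m+n K p))) (Φ-expansion-approximates (suc K) (K ℕ.+ p)))
    (≤-cancel (ℚP.+-mono-≤ (ε[1+n]+ε[2+n]≤ε[n] K) (ε-antitone (ℕP.m≤n+m p K)))
              (eq (ε (suc K)) (ε (suc (suc K))) (ε (K ℕ.+ p)) (ε K + ε p))))
    where
    eq : ∀ a b c d → (a + (b + c)) + d ≃ d + ((a + b) + c)
    eq = solve 4 (λ a b c d → (a :+ (b :+ c)) :+ d := d :+ ((a :+ b) :+ c)) ℚP.≃-refl

module _ (c : Code) where

  φ-refines-prefix : ∀ α {m n} → m ℕ.≤ n → Refines (φ c (prefix α n)) (φ c (prefix α m))
  φ-refines-prefix α {m} m≤n with ℕP.m≤n⇒∃[o]m+o≡n m≤n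
  ... | o , refl = go o
    where
    go : ∀ o → Refines (φ c (prefix α (m ℕ.+ o))) (φ c (prefix α m))
    go zero rewrite ℕP.+-identityʳ m = Refines-refl _
    go (suc o) rewrite ℕP.+-suc m o =
      Refines-trans (φ c (prefix α (m ℕ.+ o) ∷ʳ α (m ℕ.+ o))) (φ c (prefix α (m ℕ.+ o))) (φ c (prefix α m))
                    (c3 c (prefix α (m ℕ.+ o)) (α (m ℕ.+ o))) (go o)

  φ-just-≤ : ∀ s {I} → φ c s ≡ just I → proj₁ I ≤ proj₂ I
  φ-just-≤ s φ≡I = subst InT φ≡I (c1 c s)

  -- φ(ᾱ n) and the interval selected for the K-th approximation lie on one branch, so one refines
  -- the other.
  determined-near : ∀ α n {p q} → φ c (prefix α n) ≡ just (p , q) → ∀ K →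
    (p ≤ determined (fT c α) K + ε (suc K)) × (determined (fT c α) K ≤ q + ε (suc K))
  determined-near α n {p} {q} φ≡ K with determined-spec c α K
  ... | (p' , q') , φ'≡ , w , d≡p' rewrite d≡p' with ℕP.≤-total n (h c (δ (fT c α) K) α)
  ...   | inj₁ n≤m = ℚP.≤-trans p≤p' (ℚP.p≤p+q p' (ε (suc K))) ,
                     ℚP.≤-trans (φ-just-≤ _ φ'≡) (ℚP.≤-trans q'≤q (ℚP.p≤p+q q (ε (suc K))))
    where
    p≤p' = proj₁ (subst₂ Refines φ'≡ φ≡ (φ-refines-prefix α n≤m))
    q'≤q = proj₂ (subst₂ Refines φ'≡ φ≡ (φ-refines-prefix α n≤m))
  ...   | inj₂ m≤n = ℚP.≤-trans (φ-just-≤ (prefix α n) φ≡) (ℚP.≤-trans q≤q' (width≤⇒≤+ {p'} w)) ,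
                     ℚP.≤-trans p'≤p (ℚP.≤-trans (φ-just-≤ (prefix α n) φ≡) (ℚP.p≤p+q q (ε (suc K))))
    where
    p'≤p = proj₁ (subst₂ Refines φ≡ φ'≡ (φ-refines-prefix α m≤n))
    q≤q' = proj₂ (subst₂ Refines φ≡ φ'≡ (φ-refines-prefix α m≤n))

  ≃ʳ-determined⇒∈φ : ∀ {z} α → z ≃ʳ determined (fT c α) → ∀ n → z ∈ᴹ φ c (prefix α n)
  ≃ʳ-determined⇒∈φ {z} α z≃d n = ∈ᴹ-intro (φ c (prefix α n)) ∈I
    where
    ∈I : ∀ {I} → φ c (prefix α n) ≡ just I → z ∈ᴵ I
    ∈I {p , q} φ≡ M = lower-bound , upper-bound
      where
      open ℚP.≤-Reasoning
      x = z (suc (suc M))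
      d = determined (fT c α) (suc (suc M))
      x~d : Dist x d (ε (suc M))
      x~d = dist (z≃d (suc M))
      near = determined-near α n φ≡ (suc (suc M))
      slack : ε (suc M) + ε (suc (suc (suc M))) ≤ ε M
      slack = ℚP.≤-trans (ℚP.+-monoʳ-≤ (ε (suc M)) (ε-suc≤ε (suc (suc M)))) (ε[1+n]+ε[2+n]≤ε[n] M)
      lower-bound : p ≤ x + ε M
      lower-bound = begin
        p                                         ≤⟨ proj₁ near ⟩
        d + ε (suc (suc (suc M)))                 ≤⟨ ℚP.+-monoˡ-≤ (ε (suc (suc (suc M)))) (dist-≥ x~d) ⟩
        (x + ε (suc M)) + ε (suc (suc (suc M)))   ≃⟨ ℚP.+-assoc x (ε (suc M)) (ε (suc (suc (suc M)))) ⟩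
        x + (ε (suc M) + ε (suc (suc (suc M))))   ≤⟨ ℚP.+-monoʳ-≤ x slack ⟩
        x + ε M                                   ∎
      upper-bound : x ≤ q + ε M
      upper-bound = begin
        x                                         ≤⟨ dist-≤ x~d ⟩
        d + ε (suc M)                             ≤⟨ ℚP.+-monoˡ-≤ (ε (suc M)) (proj₂ near) ⟩
        (q + ε (suc (suc (suc M)))) + ε (suc M)   ≃⟨ ℚP.+-assoc q (ε (suc (suc (suc M)))) (ε (suc M)) ⟩
        q + (ε (suc (suc (suc M))) + ε (suc M))   ≃⟨ ℚP.+-congʳ q (ℚP.+-comm (ε (suc (suc (suc M)))) (ε (suc M))) ⟩
        q + (ε (suc M) + ε (suc (suc (suc M))))   ≤⟨ ℚP.+-monoʳ-≤ q slack ⟩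
        q + ε M                                   ∎

  ∈φ⇒≃ʳ-determined : ∀ (z : ℝ) α → (∀ n → seq z ∈ᴹ φ c (prefix α n)) → seq z ≃ʳ determined (fT c α)
  ∈φ⇒≃ʳ-determined z α z∈φ K with determined-spec c α (suc K)
  ... | I , φ≡I , wI , d≡left rewrite d≡left =
    ∣-∣≤ (∈ᴵ⇒dist-left z I (subst (seq z ∈ᴹ_) φ≡I (z∈φ (h c (δ (fT c α) (suc K)) α))) K wI)

expansions-𝕀-≈ᴵ : ∀ (x y : Pt01) n → Close (seq (pt x)) (seq (pt y)) (ε (suc (suc n))) →
  𝕀 (prefix (TernaryExpansion.expansion x) n) ≈ᴵ 𝕀 (prefix (TernaryExpansion.expansion y) n)
expansions-𝕀-≈ᴵ x y n x~y = dist⇒𝕀-≈ᴵ (prefix α n) (prefix β n) n (length-prefix α n) (length-prefix β n) Φα~Φβ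
  where
  open TernaryExpansion using (expansion; close-Φ-expansion)
  α = expansion x
  β = expansion y
  Φα~Φβ : Dist (Φseq α n) (Φseq β n) (ε n + ε (suc (suc n)))
  Φα~Φβ = close-const⇒dist (close-mono
    (close-trans (constℝ (Φseq α n)) (pt y) (constℝ (Φseq β n))
      (close-trans (constℝ (Φseq α n)) (pt x) (pt y) (close-sym (close-Φ-expansion x n)) x~y)
      (close-Φ-expansion y n))
    (ℚP.≤-reflexive (ℚP.≃-trans (eq (ε (suc n)) (ε (suc (suc n)))) (ℚP.+-congˡ (ε (suc (suc n))) (ε-half n)))))
    where
    eq : ∀ a b → (a + b) + a ≃ (a + a) + b
    eq = solve 2 (λ a b → (a :+ b) :+ a := (a :+ a) :+ b) ℚP.≃-refl

-- From a uniformly continuous code to a modulus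

uniformlyContinuousCode⇒uniformlyContinuous : ∀ f c → UniformlyContinuousCode c → InducedBy f c → UniformlyContinuous f
uniformlyContinuousCode⇒uniformlyContinuous f c ucc ind = ω , λ k x y x~y → close⇒≤ʳ (f-close k x y (≤ʳ⇒close x~y))
  where
  modulus : ℕ → ℕ
  modulus k = proj₁ (ucc (suc (suc k)))

  ω : ℕ → ℕ
  ω k = suc (suc (modulus k))

  f-close : ∀ k x y → Close (seq (pt x)) (seq (pt y)) (ε (ω k)) → Close (seq (app f x)) (seq (app f y)) (ε k)
  f-close k x y x~y = close-mono fx~fy 3w≤ε
    where
    open TernaryExpansion using (expansion; ≃-Φ-expansion)
    n = modulus k
    w = ε (suc (suc k))
    α = expansion x
    β = expansion y
    fΦα~fΦβ : Close (seq (app f (Φ α))) (seq (app f (Φ β))) ((w + w) + w)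
    fΦα~fΦβ = ∈ᴹ-close (app f (Φ α)) (app f (Φ β)) (φ c (prefix α n)) (φ c (prefix β n))
      (proj₂ (ucc (suc (suc k))) α) (proj₂ (ucc (suc (suc k))) β) (c4 c (prefix α n) (prefix β n) (expansions-𝕀-≈ᴵ x y n x~y))
      (≃ʳ-determined⇒∈φ c α (ind α) n) (≃ʳ-determined⇒∈φ c β (ind β) n)
    fx~fy : Close (seq (app f x)) (seq (app f y)) ((0ℚᵘ + ((w + w) + w)) + 0ℚᵘ)
    fx~fy = close-trans (app f x) (app f (Φ β)) (app f y)
      (close-trans (app f x) (app f (Φ α)) (app f (Φ β))
        (≃ʳ⇒close (ext f x (Φ α) (≃-Φ-expansion x))) fΦα~fΦβ)
      (close-sym (≃ʳ⇒close (ext f y (Φ β) (≃-Φ-expansion y))))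
    3w≤ε : (0ℚᵘ + ((w + w) + w)) + 0ℚᵘ ≤ ε k
    3w≤ε = ℚP.≤-trans (ℚP.≤-reflexive (ℚP.≃-trans (ℚP.+-identityʳ _) (ℚP.+-identityˡ _)))
      (ℚP.≤-trans (ℚP.+-monoˡ-≤ w (ℚP.≤-reflexive (ε-half (suc k)))) (ε[1+n]+ε[2+n]≤ε[n] k))

-- From a modulus to a uniformly continuous code

module CodeOfModulus (f : Fun01) (uc : UniformlyContinuous f) where

  ω : ℕ → ℕ
  ω = proj₁ uc

  f-close : ∀ k (x y : Pt01) → Close (seq (pt x)) (seq (pt y)) (ε (ω k)) →
            Close (seq (app f x)) (seq (app f y)) (ε k)
  f-close k x y x~y = ≤ʳ⇒close (proj₂ uc k x y (close⇒≤ʳ x~y))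

  ℓ-2 : ℕ → ℕ
  ℓ-2 zero    = ω 2
  ℓ-2 (suc j) = suc (suc (ℓ-2 j)) ℕ.+ ω (suc (suc (suc j)))

  ℓ : ℕ → ℕ
  ℓ j = suc (suc (ℓ-2 j))

  ε-ℓ : ∀ j → (ε (ℓ j) + ε (ℓ j)) + (ε (ℓ j) + ε (ℓ j)) ≤ ε (ω (suc (suc j)))
  ε-ℓ j = ℚP.≤-trans (ε-quarter (ℓ-2 j)) (ε-antitone (ω≤ℓ-2 j))
    where
    ω≤ℓ-2 : ∀ j → ω (suc (suc j)) ℕ.≤ ℓ-2 j
    ω≤ℓ-2 zero    = ℕP.≤-refl
    ω≤ℓ-2 (suc j) = ℕP.m≤n+m _ _

  ℓ≤ℓ-suc : ∀ j → ℓ j ℕ.≤ ℓ (suc j)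
  ℓ≤ℓ-suc j = ℕP.≤-trans (ℕP.m≤m+n (ℓ j) _) (ℕP.≤-trans (ℕP.n≤1+n _) (ℕP.n≤1+n _))

  ℓ-mono : ∀ {j k} → j ℕ.≤ k → ℓ j ℕ.≤ ℓ k
  ℓ-mono {j} j≤k with ℕP.m≤n⇒∃[o]m+o≡n j≤k
  ... | o , refl = go o
    where
    go : ∀ o → ℓ j ℕ.≤ ℓ (j ℕ.+ o)
    go zero    = ℕP.≤-reflexive (cong ℓ (sym (ℕP.+-identityʳ j)))
    go (suc o) = ℕP.≤-trans (go o) (ℕP.≤-trans (ℓ≤ℓ-suc (j ℕ.+ o)) (ℕP.≤-reflexive (cong ℓ (sym (ℕP.+-suc j o)))))

  j<ℓ : ∀ j → j ℕ.< ℓ j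
  j<ℓ zero    = ℕ.s≤s ℕ.z≤n
  j<ℓ (suc j) = ℕP.≤-trans (ℕ.s≤s (j<ℓ j)) (ℕ.s≤s (ℕP.≤-trans (ℕP.m≤m+n (ℓ j) _) (ℕP.n≤1+n _)))

  -- Opaque so that case splits on the tree never normalise the points Φ(u 1 1 1 …).
  opaque
    f-centre : Seq3 → ℝ
    f-centre u = app f (Φ (padded u))

    f-centre-close : ∀ j u v → ℓ j ℕ.≤ length u → length u ℕ.≤ length v → 𝕀 u ≈ᴵ 𝕀 v →
                     Close (seq (f-centre u)) (seq (f-centre v)) (ε (suc (suc j)))
    f-centre-close j u v ℓ≤u u≤v u≈v = f-close (suc (suc j)) (Φ (padded u)) (Φ (padded v)) (close-mono Φu~Φv Φ-bound)
      where
      L : ℕ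
      L = length v
      Φu~Φv : Close (Φseq (padded u)) (Φseq (padded v)) ((radius u + radius v) + (ε L + ε L))
      Φu~Φv = close-from-index (pt (Φ (padded u))) (pt (Φ (padded v))) L
        (dist-cong (ℚP.≃-sym (Φ-padded u u≤v)) (ℚP.≃-sym (Φ-padded v ℕP.≤-refl)) (𝕀-≈ᴵ⇒dist u v u≈v))
      ≤εℓ : ∀ {n} → length u ℕ.≤ n → ε n ≤ ε (ℓ j)
      ≤εℓ u≤n = ε-antitone (ℕP.≤-trans ℓ≤u u≤n)
      Φ-bound : (radius u + radius v) + (ε L + ε L) ≤ ε (ω (suc (suc j)))
      Φ-bound = ℚP.≤-trans (ℚP.+-mono-≤ (ℚP.+-mono-≤ (≤εℓ (ℕP.n≤1+n _)) (≤εℓ (ℕP.≤-trans u≤v (ℕP.n≤1+n _))))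
                                      (ℚP.+-mono-≤ (≤εℓ u≤v) (≤εℓ u≤v)))
                         (ε-ℓ j)

    fΦ-near-f-centre : ∀ α j M →
      Dist (seq (app f (Φ α)) (suc (suc M))) (seq (f-centre (prefix α (ℓ j))) (suc (suc (suc j)))) (ε (suc j) + ε M)
    fΦ-near-f-centre α j M = dist-mono
      (close-dist (app f (Φ α)) (f-centre u) (f-close (suc (suc j)) (Φ α) (Φ (padded u)) (close-mono Φα~Φu Φ-bound))
                  (suc (suc M)) (suc (suc (suc j))))
      (≤-cancel (ℚP.+-mono-≤ (ε[1+n]+ε[2+n]≤ε[n] (suc j)) (ε-antitone (ℕP.≤-trans (ℕP.n≤1+n M) (ℕP.n≤1+n (suc M)))))
                (eq (ε (suc (suc j))) (ε (suc (suc M))) (ε (suc (suc (suc j)))) (ε (suc j) + ε M)))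
      where
      L : ℕ
      L = ℓ j
      u : Seq3
      u = prefix α L
      prefix-padded-u : prefix (padded u) L ≡ u
      prefix-padded-u = subst (λ m → prefix (padded u) m ≡ u) (length-prefix α L) (prefix-padded u)
      Φα~Φu : Close (Φseq α) (Φseq (padded u)) (0ℚᵘ + (ε L + ε L))
      Φα~Φu = close-from-index (pt (Φ α)) (pt (Φ (padded u))) L
        (subst (λ s → Dist (Φseq α L) (dyadic s L) 0ℚᵘ) (sym prefix-padded-u) (dist-refl _ ℚP.≤-refl))
      Φ-bound : 0ℚᵘ + (ε L + ε L) ≤ ε (ω (suc (suc j)))
      Φ-bound = ℚP.≤-trans (ℚP.≤-reflexive (ℚP.+-identityˡ _)) (ℚP.≤-trans (ℚP.p≤q+p (ε L + ε L) (ε L + ε L)) (ε-ℓ j))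
      eq : ∀ a b c d → ((a + b) + c) + d ≃ d + ((a + c) + b)
      eq = solve 4 (λ a b c d → ((a :+ b) :+ c) :+ d := d :+ ((a :+ c) :+ b)) ℚP.≃-refl

  f-centres-close≤ : ∀ j k u v → j ℕ.≤ k → length u ≡ ℓ j → length v ≡ ℓ k → 𝕀 u ≈ᴵ 𝕀 v →
    Dist (seq (f-centre u) (suc (suc (suc j)))) (seq (f-centre v) (suc (suc (suc k)))) (ε (suc j) + ε (suc k))
  f-centres-close≤ j k u v j≤k u≡ v≡ u≈v =
    dist-mono (close-dist (f-centre u) (f-centre v) (f-centre-close j u v (ℕP.≤-reflexive (sym u≡)) u≤v u≈v)
                          (suc (suc (suc j))) (suc (suc (suc k))))
              (ℚP.+-mono-≤ (ε[1+n]+ε[2+n]≤ε[n] (suc j)) (ε-antitone (ℕP.≤-trans (ℕP.n≤1+n (suc k)) (ℕP.n≤1+n (suc (suc k))))))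
    where
    u≤v = ℕP.≤-trans (ℕP.≤-reflexive u≡) (ℕP.≤-trans (ℓ-mono j≤k) (ℕP.≤-reflexive (sym v≡)))

  f-centres-close : ∀ j k u v → length u ≡ ℓ j → length v ≡ ℓ k → 𝕀 u ≈ᴵ 𝕀 v →
    Dist (seq (f-centre u) (suc (suc (suc j)))) (seq (f-centre v) (suc (suc (suc k)))) (ε (suc j) + ε (suc k))
  f-centres-close j k u v u≡ v≡ u≈v with ℕP.≤-total j k
  ... | inj₁ j≤k = f-centres-close≤ j k u v j≤k u≡ v≡ u≈v
  ... | inj₂ k≤j = dist-mono (dist-sym (f-centres-close≤ k j v u k≤j v≡ u≡ (≈ᴵ-sym u≈v)))
                             (ℚP.≤-reflexive (ℚP.+-comm (ε (suc k)) (ε (suc j))))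

  approximation : ℕ → Seq3 → Interval
  approximation j s = ball (seq (f-centre (take (ℓ j) s)) (suc (suc (suc j)))) (ε (suc j))

  candidate : ℕ → Seq3 → Maybe Interval
  candidate j s with ℓ j ℕ.≤? length s
  ... | yes _ = just (approximation j s)
  ... | no _  = nothing

  candidate-defined : ∀ j s → ℓ j ℕ.≤ length s → candidate j s ≡ just (approximation j s)
  candidate-defined j s ℓ≤s with ℓ j ℕ.≤? length s
  ... | yes _  = refl
  ... | no ℓ≰s = ⊥-elim (ℓ≰s ℓ≤s)

  candidate-refines : ∀ j s i → Refines (candidate j (s ∷ʳ i)) (candidate j s)
  candidate-refines j s i with ℓ j ℕ.≤? length s | ℓ j ℕ.≤? length (s ∷ʳ i)
  ... | yes ℓ≤s | yes _ = subst (λ u → ball (seq (f-centre u) (suc (suc (suc j)))) (ε (suc j)) ⊑ approximation j s)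
                                (sym (take-++ˡ (ℓ j) s (i ∷ []) ℓ≤s)) ⊑-refl
  ... | yes ℓ≤s | no ℓ≰s∷ʳi =
    ⊥-elim (ℓ≰s∷ʳi (ℕP.≤-trans ℓ≤s (ℕP.≤-trans (ℕP.n≤1+n _) (ℕP.≤-reflexive (sym (length-∷ʳ s i))))))
  ... | no _    | _ = tt

  candidate-compatible : ∀ j k s t → 𝕀 s ≈ᴵ 𝕀 t → Compatible (candidate j s) (candidate k t)
  candidate-compatible j k s t s≈t with ℓ j ℕ.≤? length s | ℓ k ℕ.≤? length t
  ... | yes ℓj≤s | yes ℓk≤t = dist⇒ball-≈ᴵ (f-centres-close j k (take (ℓ j) s) (take (ℓ k) t)
      (length-take≤ (ℓ j) s ℓj≤s) (length-take≤ (ℓ k) t ℓk≤t) (≈ᴵ-mono (𝕀-take (ℓ j) s) (𝕀-take (ℓ k) t) s≈t))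
  ... | yes _ | no _ = tt
  ... | no _  | yes _ = tt
  ... | no _  | no _  = tt

  ⋂candidate : Seq3 → ℕ → Maybe Interval
  ⋂candidate s zero    = nothing
  ⋂candidate s (suc m) = ⋂candidate s m ⊓ᴹ candidate m s

  ⋂candidate-refines : ∀ s i m → Refines (⋂candidate (s ∷ʳ i) m) (⋂candidate s m)
  ⋂candidate-refines s i zero    = tt
  ⋂candidate-refines s i (suc m) =
    ⊓ᴹ-mono (⋂candidate (s ∷ʳ i) m) (⋂candidate s m) (candidate m (s ∷ʳ i)) (candidate m s)
            (⋂candidate-refines s i m) (candidate-refines m s i)

  ⋂candidate-refines-candidate : ∀ s {j} m → j ℕ.< m → Refines (⋂candidate s m) (candidate j s)
  ⋂candidate-refines-candidate s {j} (suc m) j<1+m with ℕP.m≤n⇒m<n∨m≡n (ℕP.≤-pred j<1+m)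
  ... | inj₂ refl = ⊓ᴹ-refinesʳ (⋂candidate s m) (candidate m s)
  ... | inj₁ j<m  = Refines-trans (⋂candidate s (suc m)) (⋂candidate s m) (candidate j s)
                      (⊓ᴹ-refinesˡ (⋂candidate s m) (candidate m s)) (⋂candidate-refines-candidate s m j<m)

  ⋂candidate-compatibleˡ : ∀ {y} s → (∀ j → Compatible (candidate j s) y) → ∀ m → Compatible (⋂candidate s m) y
  ⋂candidate-compatibleˡ s h zero    = tt
  ⋂candidate-compatibleˡ s h (suc m) = Compatible-⊓ᴹ (⋂candidate s m) (candidate m s) _ (⋂candidate-compatibleˡ s h m) (h m)

  ⋂candidate-compatible : ∀ s t → (∀ j k → Compatible (candidate j s) (candidate k t)) →
                          ∀ m m' → Compatible (⋂candidate s m) (⋂candidate t m')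
  ⋂candidate-compatible s t h m m' = ⋂candidate-compatibleˡ s (λ j → Compatible-sym (⋂candidate t m') (candidate j s)
    (⋂candidate-compatibleˡ t (λ k → Compatible-sym (candidate j s) (candidate k t) (h j k)) m')) m

  ∈-⋂candidate : ∀ {z} s → (∀ j → z ∈ᴹ candidate j s) → ∀ m → z ∈ᴹ ⋂candidate s m
  ∈-⋂candidate s z∈candidate zero    = tt
  ∈-⋂candidate s z∈candidate (suc m) =
    ∈ᴹ-⊓ᴹ (⋂candidate s m) (candidate m s) (∈-⋂candidate s z∈candidate m) (z∈candidate m)

  ∈-candidate : ∀ {z α} H j →
    (∀ M → Dist (z (suc (suc M))) (seq (f-centre (prefix α (ℓ j))) (suc (suc (suc j)))) (ε (suc j) + ε M)) →
    z ∈ᴹ candidate j (prefix α H)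
  ∈-candidate {z} {α} H j near with ℓ j ℕ.≤? length (prefix α H)
  ... | no _ = tt
  ... | yes ℓ≤H = dist⇒∈ᴵ-ball {z}
    (subst (λ u → ∀ M → Dist (z (suc (suc M))) (seq (f-centre u) (suc (suc (suc j)))) (ε (suc j) + ε M))
           (sym (take-prefix α H (ℕP.≤-trans ℓ≤H (ℕP.≤-reflexive (length-prefix α H))))) near)

  φf : Seq3 → Maybe Interval
  φf s = ⋂candidate s (length s)

  φf-compatible : ∀ s t → 𝕀 s ≈ᴵ 𝕀 t → Compatible (φf s) (φf t)
  φf-compatible s t s≈t = ⋂candidate-compatible s t (λ j k → candidate-compatible j k s t s≈t) (length s) (length t)

  φf-refines : ∀ s i → Refines (φf (s ∷ʳ i)) (φf s)
  φf-refines s i rewrite length-∷ʳ s i =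
    Refines-trans (⋂candidate (s ∷ʳ i) (suc (length s))) (⋂candidate (s ∷ʳ i) (length s)) (⋂candidate s (length s))
      (⊓ᴹ-refinesˡ _ _) (⋂candidate-refines s i (length s))

  φf-uniform : ∀ k α → Small k (φf (prefix α (ℓ k)))
  φf-uniform k α = Refines⇒Small
    (subst (Refines (φf s)) (candidate-defined k s (ℕP.≤-reflexive (sym |s|≡ℓ)))
           (⋂candidate-refines-candidate s (length s) (ℕP.≤-trans (j<ℓ k) (ℕP.≤-reflexive (sym |s|≡ℓ)))))
    (ℚP.≤-reflexive (ℚP.≃-trans (width-ball (seq (f-centre (take (ℓ k) s)) (suc (suc (suc k)))) (ε (suc k))) (ε-half k)))
    where
    s = prefix α (ℓ k)
    |s|≡ℓ = length-prefix α (ℓ k)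

  ∈-φf : ∀ α H → seq (app f (Φ α)) ∈ᴹ φf (prefix α H)
  ∈-φf α H = ∈-⋂candidate (prefix α H) (λ j → ∈-candidate H j (fΦ-near-f-centre α j)) (length (prefix α H))

  code : Code
  code = record
    { φ  = φf
    ; c1 = λ s → Compatible⇒InT (φf s) (φf-compatible s s (𝕀-self s))
    ; c2 = λ k α → ℓ k , φf-uniform k α
    ; c3 = φf-refines
    ; c4 = φf-compatible
    }

  uniform : UniformlyContinuousCode code
  uniform k = ℓ k , φf-uniform k

  induced : InducedBy f code
  induced α = ∈φ⇒≃ʳ-determined code (app f (Φ α)) α (∈-φf α)

theorem6p13 : (f : Fun01) →
    (UniformlyContinuous f → Σ Code (λ c → UniformlyContinuousCode c × InducedBy f c)) ×
    (Σ Code (λ c → UniformlyContinuousCode c × InducedBy f c) → UniformlyContinuous f)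
theorem6p13 f =
  (λ uc → let open CodeOfModulus f uc in code , uniform , induced) ,
  (λ { (c , ucc , ind) → uniformlyContinuousCode⇒uniformlyContinuous f c ucc ind })
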